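{- For every $n\ge1$, $$\sum_{\pi\in\mathcal{RS}_n}x^{{\rm des}(\pi)}=\sum_{\pi\in\mathcal{SS}_n}x^{{\rm exc}(\pi)};$$ in fact for each $k$ there is a bijection between $\{\pi\in\mathcal{RS}_n:{\rm des}(\pi)=k\}$ and $\{\sigma\in\mathcal{SS}_n:{\rm exc}(\sigma)=k\}$.
   Context: A permutation $\pi\in\mathfrak{S}_n$ (in one-line notation) is called simsun if for every $k$, the subword consisting of the letters in $[k]$ (in the order they appear) contains no three consecutive entries $a>b>c$; $\mathcal{RS}_n$ is the set of these, and ${\rm des}(\pi)=\#\{i\in[n-1]:\pi(i)>\pi(i+1)\}$. For $\pi\in\mathfrak{S}_n$, ${\rm exc}(\pi)=\#\{i:\pi(i)>i\}$. A value $x=\pi(i)$ is a double excedance if $i<x<\pi(x)$. Permutations are written in standard cycle decomposition (each cycle starts with its smallest entry, cycles ordered by increasing smallest entry); removing a letter means deleting it from its cycle (and deleting the cycle if it becomes empty), giving a permutation of the remaining letters. $\pi\in\mathfrak{S}_n$ is a simsun permutation of the second kind if for every $k\in\{0,1,\dots,n\}$, the permutation obtained by removing the $k$ largest letters of $\pi$ has no double excedances. $\mathcal{SS}_n$ is the set of these. Example: $(1,5,3,4)(2)$ is not in $\mathcal{SS}_5$, since removing $5$ gives $(1,3,4)(2)$, where $3$ is a double excedance. -}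

module Defs where

open import Data.Bool using (Bool; true; false; _∧_; _∨_; not; if_then_else_; T)
open import Data.Nat using (ℕ; zero; suc; _+_; _∸_; _^_; _<ᵇ_; _≡ᵇ_; _≤ᵇ_)
open import Data.List using (List; []; _∷_; length; map; concatMap; filterᵇ)
open import Data.Nat.ListAction using (sum)
open import Data.Bool.ListAction using (all; any)

-- Permutations of [n] = {1,…,n} are represented in one-line notation as
-- lists  w = π(1) π(2) … π(n)  of natural numbers.

oneTo : ℕ → List ℕ
oneTo zero    = []
oneTo (suc n) = oneTo n Data.List.++ (suc n ∷ [])

elem : ℕ → List ℕ → Bool
elem x []       = false
elem x (y ∷ ys) = (x ≡ᵇ y) ∨ elem x ys

isPerm : ℕ → List ℕ → Bool
isPerm n w = (length w ≡ᵇ n) ∧ all (λ j → elem j w) (oneTo n)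

insertions : ℕ → List ℕ → List (List ℕ)
insertions x []       = (x ∷ []) ∷ []
insertions x (y ∷ ys) = (x ∷ y ∷ ys) ∷ map (y ∷_) (insertions x ys)

perms : ℕ → List (List ℕ)
perms zero    = [] ∷ []
perms (suc n) = concatMap (insertions (suc n)) (perms n)

-- π(i), 1-indexed (value 0 outside the range, never used on permutations)
at : List ℕ → ℕ → ℕ
at []       _             = 0
at (x ∷ xs) zero          = 0
at (x ∷ xs) (suc zero)    = x
at (x ∷ xs) (suc (suc i)) = at xs (suc i)

des : List ℕ → ℕ
des []           = 0
des (a ∷ [])     = 0
des (a ∷ b ∷ ws) = (if b <ᵇ a then 1 else 0) + des (b ∷ ws)

noDoubleDescent : List ℕ → Bool
noDoubleDescent []               = true
noDoubleDescent (a ∷ [])         = true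
noDoubleDescent (a ∷ b ∷ [])     = true
noDoubleDescent (a ∷ b ∷ c ∷ ws) =
  not ((b <ᵇ a) ∧ (c <ᵇ b)) ∧ noDoubleDescent (b ∷ c ∷ ws)

restrictTo : ℕ → List ℕ → List ℕ
restrictTo k = filterᵇ (λ x → x ≤ᵇ k)

-- simsun: for every k (k = 0,…,n suffices; larger k give the whole word)
isSimsun : List ℕ → Bool
isSimsun w = all (λ k → noDoubleDescent (restrictTo k w)) (zero ∷ oneTo (length w))

excFrom : ℕ → List ℕ → ℕ
excFrom i []       = 0
excFrom i (x ∷ xs) = (if i <ᵇ x then 1 else 0) + excFrom (suc i) xs

exc : List ℕ → ℕ
exc = excFrom 1

hasDoubleExc : List ℕ → Bool
hasDoubleExc w =
  any (λ i → (i <ᵇ at w i) ∧ (at w i <ᵇ at w (at w i))) (oneTo (length w))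

-- Removing the largest letter m from a permutation of [m]: deleting m from
-- its cycle  (… a, m, b …)  yields  a ↦ b = π(m)  and leaves every other
-- value unchanged (if π(m) = m the singleton cycle disappears).
replaceVal : ℕ → ℕ → List ℕ → List ℕ
replaceVal m b = map (λ v → if v ≡ᵇ m then b else v)

dropLast : List ℕ → List ℕ
dropLast []           = []
dropLast (x ∷ [])     = []
dropLast (x ∷ y ∷ ys) = x ∷ dropLast (y ∷ ys)

removeLargest : List ℕ → List ℕ
removeLargest w = replaceVal (length w) (at w (length w)) (dropLast w)

noDExcAfterRemovals : ℕ → List ℕ → Bool
noDExcAfterRemovals zero    w = not (hasDoubleExc w)
noDExcAfterRemovals (suc f) w = not (hasDoubleExc w) ∧ noDExcAfterRemovals f (removeLargest w)

isSimsun2 : List ℕ → Bool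
isSimsun2 w = noDExcAfterRemovals (length w) w

RSk : ℕ → ℕ → Set
RSk n k = Σ' (List ℕ) (λ w → T (isPerm n w ∧ isSimsun w ∧ (des w ≡ᵇ k)))
  where open import Data.Product using () renaming (Σ to Σ')

SSk : ℕ → ℕ → Set
SSk n k = Σ' (List ℕ) (λ w → T (isPerm n w ∧ isSimsun2 w ∧ (exc w ≡ᵇ k)))
  where open import Data.Product using () renaming (Σ to Σ')

desPoly : ℕ → ℕ → ℕ
desPoly n x = sum (map (λ w → x ^ des w) (filterᵇ isSimsun (perms n)))

excPoly : ℕ → ℕ → ℕ
excPoly n x = sum (map (λ w → x ^ exc w) (filterᵇ isSimsun2 (perms n)))

-- Counted by their statistic, both families satisfy
--   c(n+1, k) = (k+1) c(n, k) + (n+2-2k) c(n, k-1).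
-- A simsun permutation of [n+1] arises uniquely by inserting n+1 into a simsun permutation
-- u of [n] without creating a double descent: des u + 1 slots keep des, n - 2 des u slots
-- raise it by one, and the remaining des u slots create a double descent.
-- A simsun permutation of the second kind of [n+1] arises uniquely from one, u, of [n] by
-- adding n+1 as a fixed point or right after a in its cycle.  This creates a double
-- excedance iff a is an excedance value of u, keeps exc iff a is an excedance, and raises
-- exc otherwise; no excedance is an excedance value, so again exc u + 1 choices keep exc
-- and n - 2 exc u raise it.  Equal counts give the polynomial identity, and the bijections
-- go through Fin.
module Submission where

open import Defs
open import Data.Bool using (Bool; true; false; _∧_; _∨_; not; if_then_else_; T)
open import Data.Bool.Properties
  using (T-irrelevant; ∧-zeroʳ; ∧-identityʳ; ∧-assoc; ∧-comm; ∨-zeroʳ; ∨-identityʳ; ∨-assoc)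
open import Data.Bool.ListAction using (all; any)
open import Data.Nat using (ℕ; zero; suc; _+_; _*_; _^_; _∸_; _≤_; _<_; z≤n; s≤s; _≡ᵇ_; _<ᵇ_; _≤ᵇ_)
open import Data.Nat.Properties
open import Data.Nat.ListAction using (sum)
open import Data.Nat.Tactic.RingSolver using (solve-∀)
open import Data.List using (List; []; _∷_; length; map; concatMap; filterᵇ; _++_)
open import Data.List.Properties using (length-++; length-map; ∷-injectiveˡ; ∷-injectiveʳ)
open import Data.List.Relation.Unary.All using (All; []; _∷_)
open import Data.Fin as Fin using (Fin)
open import Data.Product using (Σ; _×_; _,_; proj₁; proj₂)
open import Data.Sum using (_⊎_; inj₁; inj₂)
open import Data.Empty using (⊥; ⊥-elim)
open import Relation.Nullary using (yes; no)
open import Relation.Binary.PropositionalEquality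
open import Function.Bundles using (_↔_; mk↔ₛ′)
open import Function.Properties.Inverse using (↔-trans; ↔-sym)
open import Algebra.Properties.CommutativeSemigroup +-commutativeSemigroup using (x∙yz≈y∙xz; interchange)

true≢false : true ≢ false
true≢false ()

T⇒≡true : ∀ {b} → T b → b ≡ true
T⇒≡true {true} _ = refl

≡true⇒T : ∀ {b} → b ≡ true → T b
≡true⇒T refl = _

≢true⇒≡false : ∀ {b} → (b ≡ true → ⊥) → b ≡ false
≢true⇒≡false {true} h = ⊥-elim (h refl)
≢true⇒≡false {false} _ = refl

∧-true : ∀ {a b} → a ≡ true → b ≡ true → a ∧ b ≡ true
∧-true refl refl = refl

∧-trueˡ : ∀ {a b} → a ∧ b ≡ true → a ≡ true
∧-trueˡ {true} _ = refl

∧-trueʳ : ∀ {a b} → a ∧ b ≡ true → b ≡ true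
∧-trueʳ {true} h = h

∨-left-comm : ∀ a b c → a ∨ (b ∨ c) ≡ b ∨ (a ∨ c)
∨-left-comm true true c = refl
∨-left-comm true false c = refl
∨-left-comm false true c = refl
∨-left-comm false false c = refl

∨-true : ∀ {a b} → a ∨ b ≡ true → a ≡ true ⊎ b ≡ true
∨-true {true} _ = inj₁ refl
∨-true {false} h = inj₂ h

≡ᵇ⇒≡′ : ∀ {x y} → (x ≡ᵇ y) ≡ true → x ≡ y
≡ᵇ⇒≡′ {x} {y} h = ≡ᵇ⇒≡ x y (≡true⇒T h)

≡ᵇ-refl : ∀ x → (x ≡ᵇ x) ≡ true
≡ᵇ-refl x = T⇒≡true (≡⇒≡ᵇ x x refl)

<ᵇ-true : ∀ {a b} → a < b → (a <ᵇ b) ≡ true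
<ᵇ-true lt = T⇒≡true (<⇒<ᵇ lt)

<ᵇ-false : ∀ {a b} → b ≤ a → (a <ᵇ b) ≡ false
<ᵇ-false {a} {b} b≤a with a <ᵇ b in eq
... | true = ⊥-elim (<⇒≱ (<ᵇ⇒< a b (≡true⇒T eq)) b≤a)
... | false = refl

≤ᵇ-true : ∀ {a b} → a ≤ b → (a ≤ᵇ b) ≡ true
≤ᵇ-true le = T⇒≡true (≤⇒≤ᵇ le)

≤ᵇ-false : ∀ {a b} → b < a → (a ≤ᵇ b) ≡ false
≤ᵇ-false {a} {b} b<a with a ≤ᵇ b in eq
... | true = ⊥-elim (<⇒≱ b<a (≤ᵇ⇒≤ a b (≡true⇒T eq)))
... | false = refl

⟦_⟧ : Bool → ℕ
⟦ true ⟧ = 1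
⟦ false ⟧ = 0

⟦⟧≡if : ∀ b → ⟦ b ⟧ ≡ (if b then 1 else 0)
⟦⟧≡if true = refl
⟦⟧≡if false = refl

countᵇ : ∀ {A : Set} → (A → Bool) → List A → ℕ
countᵇ p [] = 0
countᵇ p (x ∷ xs) = ⟦ p x ⟧ + countᵇ p xs

sumBy : ∀ {A : Set} → (A → ℕ) → List A → ℕ
sumBy h [] = 0
sumBy h (x ∷ xs) = h x + sumBy h xs

module _ {A : Set} where

  filterᵇ-∷ : ∀ (p : A → Bool) x xs →
    filterᵇ p (x ∷ xs) ≡ (if p x then x ∷ filterᵇ p xs else filterᵇ p xs)
  filterᵇ-∷ p x xs with p x
  ... | true = refl
  ... | false = refl

  length-filterᵇ : ∀ (p : A → Bool) xs → length (filterᵇ p xs) ≡ countᵇ p xs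
  length-filterᵇ p [] = refl
  length-filterᵇ p (x ∷ xs) with p x
  ... | true = cong suc (length-filterᵇ p xs)
  ... | false = length-filterᵇ p xs

  countᵇ-++ : ∀ (p : A → Bool) xs ys → countᵇ p (xs ++ ys) ≡ countᵇ p xs + countᵇ p ys
  countᵇ-++ p [] ys = refl
  countᵇ-++ p (x ∷ xs) ys = trans (cong (⟦ p x ⟧ +_) (countᵇ-++ p xs ys)) (sym (+-assoc ⟦ p x ⟧ _ _))

  countᵇ-cong : ∀ (p q : A → Bool) xs → (∀ x → p x ≡ q x) → countᵇ p xs ≡ countᵇ q xs
  countᵇ-cong p q [] h = refl
  countᵇ-cong p q (x ∷ xs) h = cong₂ _+_ (cong ⟦_⟧ (h x)) (countᵇ-cong p q xs h)

  countᵇ+countᵇ-not : ∀ (p : A → Bool) xs → countᵇ p xs + countᵇ (λ x → not (p x)) xs ≡ length xs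
  countᵇ+countᵇ-not p [] = refl
  countᵇ+countᵇ-not p (x ∷ xs) with p x
  ... | true = cong suc (countᵇ+countᵇ-not p xs)
  ... | false = trans (+-suc (countᵇ p xs) _) (cong suc (countᵇ+countᵇ-not p xs))

  countᵇ-false : ∀ (xs : List A) → countᵇ (λ _ → false) xs ≡ 0
  countᵇ-false [] = refl
  countᵇ-false (x ∷ xs) = countᵇ-false xs

  countᵇ-true : ∀ (xs : List A) → countᵇ (λ _ → true) xs ≡ length xs
  countᵇ-true [] = refl
  countᵇ-true (x ∷ xs) = cong suc (countᵇ-true xs)

  countᵇ-split : ∀ (p q : A → Bool) xs →
    countᵇ p xs ≡ countᵇ (λ a → p a ∧ q a) xs + countᵇ (λ a → p a ∧ not (q a)) xs
  countᵇ-split p q [] = refl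
  countᵇ-split p q (x ∷ xs) with p x | q x
  ... | true | true = cong suc (countᵇ-split p q xs)
  ... | true | false = trans (cong suc (countᵇ-split p q xs)) (sym (+-suc _ _))
  ... | false | _ = countᵇ-split p q xs

  countᵇ-if : ∀ (excluded keeps : A → Bool) e k xs →
    countᵇ (λ a → not (excluded a) ∧ ((if keeps a then e else suc e) ≡ᵇ k)) xs
      ≡ ⟦ e ≡ᵇ k ⟧ * countᵇ (λ a → not (excluded a) ∧ keeps a) xs
        + ⟦ suc e ≡ᵇ k ⟧ * countᵇ (λ a → not (excluded a) ∧ not (keeps a)) xs
  countᵇ-if excluded keeps e k [] = sym (cong₂ _+_ (*-zeroʳ ⟦ e ≡ᵇ k ⟧) (*-zeroʳ ⟦ suc e ≡ᵇ k ⟧))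
  countᵇ-if excluded keeps e k (x ∷ xs) =
    trans (cong₂ _+_ (single (excluded x) (keeps x)) (countᵇ-if excluded keeps e k xs))
          (distrib ⟦ e ≡ᵇ k ⟧ ⟦ suc e ≡ᵇ k ⟧ _ _ _ _)
    where
      i = ⟦ e ≡ᵇ k ⟧
      j = ⟦ suc e ≡ᵇ k ⟧
      distrib : ∀ i j a b c d → (i * a + j * b) + (i * c + j * d) ≡ i * (a + c) + j * (b + d)
      distrib = solve-∀
      single : ∀ b c → ⟦ not b ∧ ((if c then e else suc e) ≡ᵇ k) ⟧ ≡ i * ⟦ not b ∧ c ⟧ + j * ⟦ not b ∧ not c ⟧
      single true _ = sym (cong₂ _+_ (*-zeroʳ i) (*-zeroʳ j))
      single false true = sym (trans (cong₂ _+_ (*-identityʳ i) (*-zeroʳ j)) (+-identityʳ i))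
      single false false = sym (cong₂ _+_ (*-zeroʳ i) (*-identityʳ j))

module _ {A B : Set} where

  countᵇ-concatMap : ∀ (p : B → Bool) (f : A → List B) xs →
    countᵇ p (concatMap f xs) ≡ sumBy (λ u → countᵇ p (f u)) xs
  countᵇ-concatMap p f [] = refl
  countᵇ-concatMap p f (u ∷ xs) =
    trans (countᵇ-++ p (f u) (concatMap f xs)) (cong (countᵇ p (f u) +_) (countᵇ-concatMap p f xs))

  countᵇ-map : ∀ (p : B → Bool) (f : A → B) xs → countᵇ p (map f xs) ≡ countᵇ (λ x → p (f x)) xs
  countᵇ-map p f [] = refl
  countᵇ-map p f (x ∷ xs) = cong (⟦ p (f x) ⟧ +_) (countᵇ-map p f xs)

+-squeezeˡ : ∀ {a b c d} → a ≤ c → b ≤ d → a + b ≡ c + d → a ≡ c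
+-squeezeˡ a≤c b≤d eq with m≤n⇒m<n∨m≡n a≤c
... | inj₂ a≡c = a≡c
... | inj₁ a<c = ⊥-elim (<⇒≢ (+-mono-<-≤ a<c b≤d) eq)

module Membership {A : Set} (_==_ : A → A → Bool)
                  (==⇒≡ : ∀ {x y} → (x == y) ≡ true → x ≡ y)
                  (==-refl : ∀ x → (x == x) ≡ true) where

  mem : A → List A → Bool
  mem x [] = false
  mem x (y ∷ ys) = (x == y) ∨ mem x ys

  data Nodup : List A → Set where
    []ₙ : Nodup []
    _∷ₙ_ : ∀ {x xs} → mem x xs ≡ false → Nodup xs → Nodup (x ∷ xs)

  remove : A → List A → List A
  remove x [] = []
  remove x (y ∷ ys) = if x == y then ys else y ∷ remove x ys

  ≢⇒==-false : ∀ {x y} → x ≢ y → (x == y) ≡ false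
  ≢⇒==-false {x} {y} x≢y with x == y in eq
  ... | true = ⊥-elim (x≢y (==⇒≡ eq))
  ... | false = refl

  mem-here : ∀ x xs → mem x (x ∷ xs) ≡ true
  mem-here x xs rewrite ==-refl x = refl

  mem-there : ∀ x y xs → mem x xs ≡ true → mem x (y ∷ xs) ≡ true
  mem-there x y xs h rewrite h = ∨-zeroʳ (x == y)

  mem-∷ : ∀ {x y xs} → mem x (y ∷ xs) ≡ true → x ≡ y ⊎ mem x xs ≡ true
  mem-∷ {x} {y} h with x == y in eq
  ... | true = inj₁ (==⇒≡ eq)
  ... | false = inj₂ h

  ¬mem-∷ : ∀ {x y xs} → mem x (y ∷ xs) ≡ false → x ≢ y × mem x xs ≡ false
  ¬mem-∷ {x} {y} h with x == y in eq
  ... | true = ⊥-elim (true≢false h)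
  ... | false = (λ { refl → true≢false (trans (sym (==-refl x)) eq) }) , h

  mem-++ : ∀ z xs ys → mem z (xs ++ ys) ≡ mem z xs ∨ mem z ys
  mem-++ z [] ys = refl
  mem-++ z (x ∷ xs) ys rewrite mem-++ z xs ys = sym (∨-assoc (z == x) _ _)

  mem-subst : ∀ {x y} xs → x ≡ y → mem x xs ≡ true → mem y xs ≡ true
  mem-subst xs refl h = h

  mem-≢ : ∀ {x y} xs → mem x xs ≡ true → mem y xs ≡ false → x ≢ y
  mem-≢ xs mx my refl = true≢false (trans (sym mx) my)

  countᵇ-remove : ∀ (p : A → Bool) x ys → mem x ys ≡ true →
    countᵇ p ys ≡ ⟦ p x ⟧ + countᵇ p (remove x ys)
  countᵇ-remove p x [] ()
  countᵇ-remove p x (y ∷ ys) h with x == y in eq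
  ... | true rewrite ==⇒≡ eq = refl
  ... | false = trans (cong (⟦ p y ⟧ +_) (countᵇ-remove p x ys h)) (x∙yz≈y∙xz ⟦ p y ⟧ ⟦ p x ⟧ _)

  length-remove : ∀ x ys → mem x ys ≡ true → length ys ≡ suc (length (remove x ys))
  length-remove x ys h =
    trans (sym (countᵇ-true ys)) (trans (countᵇ-remove (λ _ → true) x ys h) (cong suc (countᵇ-true (remove x ys))))

  mem-remove : ∀ z x ys → mem z ys ≡ true → z ≢ x → mem z (remove x ys) ≡ true
  mem-remove z x [] () z≢x
  mem-remove z x (y ∷ ys) h z≢x with x == y in eq | mem-∷ {z} {y} {ys} h
  ... | true | inj₁ z≡y = ⊥-elim (z≢x (trans z≡y (sym (==⇒≡ eq))))
  ... | true | inj₂ m = m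
  ... | false | inj₁ refl = mem-here z (remove x ys)
  ... | false | inj₂ m = mem-there z y (remove x ys) (mem-remove z x ys m z≢x)

  countᵇ-⊆ : ∀ (p : A → Bool) xs ys → Nodup xs → (∀ z → mem z xs ≡ true → mem z ys ≡ true) →
    countᵇ p xs ≤ countᵇ p ys
  countᵇ-⊆ p [] ys nd h = z≤n
  countᵇ-⊆ p (x ∷ xs) ys (x∉xs ∷ₙ nd) h =
    subst (⟦ p x ⟧ + countᵇ p xs ≤_) (sym (countᵇ-remove p x ys (h x (mem-here x xs))))
      (+-monoʳ-≤ ⟦ p x ⟧ (countᵇ-⊆ p xs (remove x ys) nd
        (λ z m → mem-remove z x ys (h z (mem-there z x xs m)) (mem-≢ xs m x∉xs))))

  countᵇ-⊆-length : ∀ (p : A → Bool) xs ys → Nodup xs → (∀ z → mem z xs ≡ true → mem z ys ≡ true) →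
    length xs ≡ length ys → countᵇ p xs ≡ countᵇ p ys
  countᵇ-⊆-length p xs ys nd h eq =
    +-squeezeˡ (countᵇ-⊆ p xs ys nd h) (countᵇ-⊆ (λ x → not (p x)) xs ys nd h)
      (trans (countᵇ+countᵇ-not p xs) (trans eq (sym (countᵇ+countᵇ-not p ys))))

  length-⊆-antisym : ∀ xs ys → Nodup xs → Nodup ys →
    (∀ z → mem z xs ≡ true → mem z ys ≡ true) → (∀ z → mem z ys ≡ true → mem z xs ≡ true) → length xs ≡ length ys
  length-⊆-antisym xs ys ndx ndy xs⊆ys ys⊆xs = ≤-antisym
    (subst₂ _≤_ (countᵇ-true xs) (countᵇ-true ys) (countᵇ-⊆ (λ _ → true) xs ys ndx xs⊆ys))
    (subst₂ _≤_ (countᵇ-true ys) (countᵇ-true xs) (countᵇ-⊆ (λ _ → true) ys xs ndy ys⊆xs))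

  nodup-++ : ∀ xs ys → Nodup xs → Nodup ys → (∀ z → mem z xs ≡ true → mem z ys ≡ false) → Nodup (xs ++ ys)
  nodup-++ [] ys nx ny h = ny
  nodup-++ (x ∷ xs) ys (x∉xs ∷ₙ nx) ny h =
    (trans (mem-++ x xs ys) (cong₂ _∨_ x∉xs (h x (mem-here x xs))))
    ∷ₙ nodup-++ xs ys nx ny (λ z m → h z (mem-there z x xs m))

  mem-concatMap⁻ : ∀ z (f : A → List A) xs → mem z (concatMap f xs) ≡ true →
    Σ A (λ u → mem u xs ≡ true × mem z (f u) ≡ true)
  mem-concatMap⁻ z f [] ()
  mem-concatMap⁻ z f (u ∷ xs) h with mem z (f u) in e
  ... | true = u , mem-here u xs , e
  ... | false with mem-concatMap⁻ z f xs (trans (sym (trans (mem-++ z (f u) (concatMap f xs)) (cong (_∨ _) e))) h)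
  ...   | (u′ , m₁ , m₂) = u′ , mem-there u′ u xs m₁ , m₂

  mem-concatMap⁺ : ∀ z (f : A → List A) xs u → mem u xs ≡ true → mem z (f u) ≡ true →
    mem z (concatMap f xs) ≡ true
  mem-concatMap⁺ z f [] u () m₂
  mem-concatMap⁺ z f (u′ ∷ xs) u m₁ m₂ rewrite mem-++ z (f u′) (concatMap f xs) with mem-∷ {u} {u′} {xs} m₁
  ... | inj₁ refl rewrite m₂ = refl
  ... | inj₂ m rewrite mem-concatMap⁺ z f xs u m m₂ = ∨-zeroʳ _

  -- The blocks f u are disjoint because g recovers u from every element of f u.
  nodup-concatMap : ∀ (f : A → List A) (g : A → A) xs → Nodup xs → (∀ u → mem u xs ≡ true → Nodup (f u)) →
    (∀ u v → mem u xs ≡ true → mem v (f u) ≡ true → g v ≡ u) → Nodup (concatMap f xs)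
  nodup-concatMap f g [] nd h₁ h₂ = []ₙ
  nodup-concatMap f g (u ∷ xs) (u∉xs ∷ₙ nd) h₁ h₂ =
    nodup-++ (f u) (concatMap f xs) (h₁ u (mem-here u xs))
      (nodup-concatMap f g xs nd (λ u′ m → h₁ u′ (mem-there u′ u xs m)) (λ u′ v m → h₂ u′ v (mem-there u′ u xs m)))
      (λ z z∈fu → ≢true⇒≡false (λ z∈rest →
        let (u′ , m₁ , m₂) = mem-concatMap⁻ z f xs z∈rest
            u≡u′ = trans (sym (h₂ u z (mem-here u xs) z∈fu)) (h₂ u′ z (mem-there u′ u xs m₁) m₂)
        in mem-≢ xs m₁ u∉xs (sym u≡u′)))

  mem-map⁻ : ∀ z (f : A → A) xs → mem z (map f xs) ≡ true → Σ A (λ x → mem x xs ≡ true × f x ≡ z)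
  mem-map⁻ z f [] ()
  mem-map⁻ z f (x ∷ xs) h with mem-∷ {z} {f x} {map f xs} h
  ... | inj₁ e = x , mem-here x xs , sym e
  ... | inj₂ m with mem-map⁻ z f xs m
  ...   | (x′ , m₁ , e) = x′ , mem-there x′ x xs m₁ , e

  mem-map⁺ : ∀ (f : A → A) x xs → mem x xs ≡ true → mem (f x) (map f xs) ≡ true
  mem-map⁺ f x [] ()
  mem-map⁺ f x (y ∷ xs) h with mem-∷ {x} {y} {xs} h
  ... | inj₁ refl = mem-here (f x) (map f xs)
  ... | inj₂ m = mem-there (f x) (f y) (map f xs) (mem-map⁺ f x xs m)

  nodup-map : ∀ (f : A → A) xs → Nodup xs →
    (∀ x y → mem x xs ≡ true → mem y xs ≡ true → f x ≡ f y → x ≡ y) → Nodup (map f xs)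
  nodup-map f [] nd h = []ₙ
  nodup-map f (x ∷ xs) (x∉xs ∷ₙ nd) h =
    ≢true⇒≡false (λ m → let (y , m₁ , e) = mem-map⁻ (f x) f xs m in
       mem-≢ xs m₁ x∉xs (h y x (mem-there y x xs m₁) (mem-here x xs) e))
    ∷ₙ nodup-map f xs nd (λ a b ma mb → h a b (mem-there a x xs ma) (mem-there b x xs mb))

  mem-filterᵇ : ∀ z (q : A → Bool) xs → mem z (filterᵇ q xs) ≡ mem z xs ∧ q z
  mem-filterᵇ z q [] = refl
  mem-filterᵇ z q (x ∷ xs) rewrite filterᵇ-∷ q x xs with q x in eq | z == x in ez
  ... | true | true rewrite ==⇒≡ ez | eq | ==-refl x = refl
  ... | true | false rewrite ez = mem-filterᵇ z q xs
  ... | false | true rewrite ==⇒≡ ez =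
    trans (mem-filterᵇ x q xs) (trans (cong (mem x xs ∧_) eq) (trans (∧-zeroʳ _) (sym eq)))
  ... | false | false = mem-filterᵇ z q xs

  nodup-filterᵇ : ∀ (q : A → Bool) xs → Nodup xs → Nodup (filterᵇ q xs)
  nodup-filterᵇ q [] nd = []ₙ
  nodup-filterᵇ q (x ∷ xs) (x∉xs ∷ₙ nd) with q x
  ... | true = trans (mem-filterᵇ x q xs) (cong (_∧ q x) x∉xs) ∷ₙ nodup-filterᵇ q xs nd
  ... | false = nodup-filterᵇ q xs nd

  countᵇ-cong-mem : ∀ (p q : A → Bool) xs → (∀ w → mem w xs ≡ true → p w ≡ q w) → countᵇ p xs ≡ countᵇ q xs
  countᵇ-cong-mem p q [] h = refl
  countᵇ-cong-mem p q (x ∷ xs) h =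
    cong₂ _+_ (cong ⟦_⟧ (h x (mem-here x xs))) (countᵇ-cong-mem p q xs (λ w m → h w (mem-there w x xs m)))

  sumBy-cong-mem : ∀ (h h′ : A → ℕ) xs → (∀ w → mem w xs ≡ true → h w ≡ h′ w) → sumBy h xs ≡ sumBy h′ xs
  sumBy-cong-mem h h′ [] e = refl
  sumBy-cong-mem h h′ (x ∷ xs) e =
    cong₂ _+_ (e x (mem-here x xs)) (sumBy-cong-mem h h′ xs (λ w m → e w (mem-there w x xs m)))

  any-true⁻ : ∀ (p : A → Bool) xs → any p xs ≡ true → Σ A (λ x → mem x xs ≡ true × p x ≡ true)
  any-true⁻ p [] ()
  any-true⁻ p (x ∷ xs) h with p x in e
  ... | true = x , mem-here x xs , e
  ... | false with any-true⁻ p xs h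
  ...   | (y , m , e′) = y , mem-there y x xs m , e′

  any-true⁺ : ∀ (p : A → Bool) xs x → mem x xs ≡ true → p x ≡ true → any p xs ≡ true
  any-true⁺ p [] x () e
  any-true⁺ p (y ∷ xs) x m e with mem-∷ {x} {y} {xs} m
  ... | inj₁ refl rewrite e = refl
  ... | inj₂ m′ rewrite any-true⁺ p xs x m′ e = ∨-zeroʳ _

  any-false⁻ : ∀ (p : A → Bool) xs x → any p xs ≡ false → mem x xs ≡ true → p x ≡ false
  any-false⁻ p xs x h m = ≢true⇒≡false (λ e → true≢false (trans (sym (any-true⁺ p xs x m e)) h))

  lookup : (xs : List A) → Fin (length xs) → A
  lookup (x ∷ xs) Fin.zero = x
  lookup (x ∷ xs) (Fin.suc i) = lookup xs i

  mem-lookup : ∀ xs i → mem (lookup xs i) xs ≡ true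
  mem-lookup (x ∷ xs) Fin.zero = mem-here x xs
  mem-lookup (x ∷ xs) (Fin.suc i) = mem-there _ x xs (mem-lookup xs i)

  index : ∀ z xs → mem z xs ≡ true → Fin (length xs)
  index z [] ()
  index z (y ∷ xs) h with z == y
  ... | true = Fin.zero
  ... | false = Fin.suc (index z xs h)

  lookup-index : ∀ z xs h → lookup xs (index z xs h) ≡ z
  lookup-index z [] ()
  lookup-index z (y ∷ xs) h with z == y in eq
  ... | true = sym (==⇒≡ eq)
  ... | false = lookup-index z xs h

  index-lookup : ∀ xs → Nodup xs → ∀ i h → index (lookup xs i) xs h ≡ i
  index-lookup (x ∷ xs) nd Fin.zero h rewrite ==-refl x = refl
  index-lookup (x ∷ xs) (x∉xs ∷ₙ nd) (Fin.suc i) h with lookup xs i == x in eq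
  ... | true = ⊥-elim (mem-≢ xs (mem-lookup xs i) x∉xs (==⇒≡ eq))
  ... | false = cong Fin.suc (index-lookup xs nd i h)

  members↔Fin : ∀ xs → Nodup xs → Σ A (λ z → T (mem z xs)) ↔ Fin (length xs)
  members↔Fin xs nd = mk↔ₛ′
    (λ (z , t) → index z xs (T⇒≡true t))
    (λ i → lookup xs i , ≡true⇒T (mem-lookup xs i))
    (λ i → index-lookup xs nd i _)
    (λ (z , t) → Σ-≡ (lookup-index z xs (T⇒≡true t)))
    where
      Σ-≡ : ∀ {z z′} {t : T (mem z xs)} {t′ : T (mem z′ xs)} → z ≡ z′ →
        _≡_ {A = Σ A (λ z → T (mem z xs))} (z , t) (z′ , t′)
      Σ-≡ refl = cong (_ ,_) (T-irrelevant _ _)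

_==ᴸ_ : List ℕ → List ℕ → Bool
[] ==ᴸ [] = true
[] ==ᴸ (_ ∷ _) = false
(_ ∷ _) ==ᴸ [] = false
(x ∷ xs) ==ᴸ (y ∷ ys) = (x ≡ᵇ y) ∧ (xs ==ᴸ ys)

==ᴸ⇒≡ : ∀ {xs ys} → (xs ==ᴸ ys) ≡ true → xs ≡ ys
==ᴸ⇒≡ {[]} {[]} _ = refl
==ᴸ⇒≡ {x ∷ xs} {y ∷ ys} h with x ≡ᵇ y in e
... | true = cong₂ _∷_ (≡ᵇ⇒≡′ e) (==ᴸ⇒≡ h)

==ᴸ-refl : ∀ xs → (xs ==ᴸ xs) ≡ true
==ᴸ-refl [] = refl
==ᴸ-refl (x ∷ xs) rewrite ≡ᵇ-refl x = ==ᴸ-refl xs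

module N = Membership _≡ᵇ_ ≡ᵇ⇒≡′ ≡ᵇ-refl
module L = Membership _==ᴸ_ ==ᴸ⇒≡ ==ᴸ-refl

elem≡mem : ∀ x ys → elem x ys ≡ N.mem x ys
elem≡mem x [] = refl
elem≡mem x (y ∷ ys) = cong ((x ≡ᵇ y) ∨_) (elem≡mem x ys)

all-snoc : ∀ (p : ℕ → Bool) xs y → all p (xs ++ y ∷ []) ≡ all p xs ∧ p y
all-snoc p [] y = ∧-identityʳ _
all-snoc p (x ∷ xs) y rewrite all-snoc p xs y = sym (∧-assoc (p x) _ _)

any-snoc : ∀ (p : ℕ → Bool) xs y → any p (xs ++ y ∷ []) ≡ any p xs ∨ p y
any-snoc p [] y = ∨-identityʳ _
any-snoc p (x ∷ xs) y rewrite any-snoc p xs y = sym (∨-assoc (p x) _ _)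

all-oneTo⁺ : ∀ (p : ℕ → Bool) n → (∀ j → 1 ≤ j → j ≤ n → p j ≡ true) → all p (oneTo n) ≡ true
all-oneTo⁺ p zero h = refl
all-oneTo⁺ p (suc n) h rewrite all-snoc p (oneTo n) (suc n) =
  ∧-true (all-oneTo⁺ p n (λ j a b → h j a (m≤n⇒m≤1+n b))) (h (suc n) (s≤s z≤n) ≤-refl)

all-oneTo⁻ : ∀ (p : ℕ → Bool) n → all p (oneTo n) ≡ true → ∀ j → 1 ≤ j → j ≤ n → p j ≡ true
all-oneTo⁻ p zero h j a b = ⊥-elim (1+n≰n (≤-trans a b))
all-oneTo⁻ p (suc n) h j a b rewrite all-snoc p (oneTo n) (suc n) with m≤n⇒m<n∨m≡n b
... | inj₁ lt = all-oneTo⁻ p n (∧-trueˡ h) j a (≤-pred lt)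
... | inj₂ refl = ∧-trueʳ h

all-cong-oneTo : ∀ (p q : ℕ → Bool) n → (∀ j → 1 ≤ j → j ≤ n → p j ≡ q j) → all p (oneTo n) ≡ all q (oneTo n)
all-cong-oneTo p q zero h = refl
all-cong-oneTo p q (suc n) h rewrite all-snoc p (oneTo n) (suc n) | all-snoc q (oneTo n) (suc n) =
  cong₂ _∧_ (all-cong-oneTo p q n (λ j a b → h j a (m≤n⇒m≤1+n b))) (h (suc n) (s≤s z≤n) ≤-refl)

any-cong-oneTo : ∀ (p q : ℕ → Bool) n → (∀ j → 1 ≤ j → j ≤ n → p j ≡ q j) → any p (oneTo n) ≡ any q (oneTo n)
any-cong-oneTo p q zero h = refl
any-cong-oneTo p q (suc n) h rewrite any-snoc p (oneTo n) (suc n) | any-snoc q (oneTo n) (suc n) =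
  cong₂ _∨_ (any-cong-oneTo p q n (λ j a b → h j a (m≤n⇒m≤1+n b))) (h (suc n) (s≤s z≤n) ≤-refl)

mem-oneTo⁻ : ∀ n j → N.mem j (oneTo n) ≡ true → 1 ≤ j × j ≤ n
mem-oneTo⁻ zero j ()
mem-oneTo⁻ (suc n) j m rewrite N.mem-++ j (oneTo n) (suc n ∷ []) with ∨-true {N.mem j (oneTo n)} m
... | inj₁ m′ = proj₁ (mem-oneTo⁻ n j m′) , m≤n⇒m≤1+n (proj₂ (mem-oneTo⁻ n j m′))
... | inj₂ m′ with ∨-true {j ≡ᵇ suc n} m′
...   | inj₁ e rewrite ≡ᵇ⇒≡′ {j} {suc n} e = s≤s z≤n , ≤-refl

mem-oneTo⁺ : ∀ n j → 1 ≤ j → j ≤ n → N.mem j (oneTo n) ≡ true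
mem-oneTo⁺ zero j a b = ⊥-elim (1+n≰n (≤-trans a b))
mem-oneTo⁺ (suc n) j a b rewrite N.mem-++ j (oneTo n) (suc n ∷ []) with m≤n⇒m<n∨m≡n b
... | inj₁ lt rewrite mem-oneTo⁺ n j a (≤-pred lt) = refl
... | inj₂ refl rewrite ≡ᵇ-refl (suc n) = ∨-zeroʳ _

nodup-oneTo : ∀ n → N.Nodup (oneTo n)
nodup-oneTo zero = N.[]ₙ
nodup-oneTo (suc n) = N.nodup-++ (oneTo n) (suc n ∷ []) (nodup-oneTo n) (refl N.∷ₙ N.[]ₙ)
  (λ z m → trans (∨-identityʳ (z ≡ᵇ suc n)) (N.≢⇒==-false {z} {suc n} (λ { refl → 1+n≰n (proj₂ (mem-oneTo⁻ n z m)) })))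

length-oneTo : ∀ n → length (oneTo n) ≡ n
length-oneTo zero = refl
length-oneTo (suc n) = trans (length-++ (oneTo n)) (trans (+-comm (length (oneTo n)) 1) (cong suc (length-oneTo n)))

countᵇ-oneTo-suc : ∀ (p : ℕ → Bool) n → countᵇ p (oneTo (suc n)) ≡ countᵇ p (oneTo n) + ⟦ p (suc n) ⟧
countᵇ-oneTo-suc p n = trans (countᵇ-++ p (oneTo n) (suc n ∷ [])) (cong (countᵇ p (oneTo n) +_) (+-identityʳ _))

countᵇ-oneTo-shift : ∀ (p : ℕ → Bool) n → countᵇ p (oneTo (suc n)) ≡ ⟦ p 1 ⟧ + countᵇ (λ i → p (suc i)) (oneTo n)
countᵇ-oneTo-shift p zero = refl
countᵇ-oneTo-shift p (suc n) = begin
  countᵇ p (oneTo (suc (suc n)))                                       ≡⟨ countᵇ-oneTo-suc p (suc n) ⟩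
  countᵇ p (oneTo (suc n)) + ⟦ p (suc (suc n)) ⟧                       ≡⟨ cong (_+ ⟦ p (suc (suc n)) ⟧) (countᵇ-oneTo-shift p n) ⟩
  ⟦ p 1 ⟧ + countᵇ (λ i → p (suc i)) (oneTo n) + ⟦ p (suc (suc n)) ⟧   ≡⟨ +-assoc ⟦ p 1 ⟧ _ _ ⟩
  ⟦ p 1 ⟧ + (countᵇ (λ i → p (suc i)) (oneTo n) + ⟦ p (suc (suc n)) ⟧) ≡⟨ cong (⟦ p 1 ⟧ +_) (sym (countᵇ-oneTo-suc _ n)) ⟩
  ⟦ p 1 ⟧ + countᵇ (λ i → p (suc i)) (oneTo (suc n))                   ∎
  where open ≡-Reasoning

countᵇ-cong-oneTo : ∀ (p q : ℕ → Bool) n → (∀ j → 1 ≤ j → j ≤ n → p j ≡ q j) →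
  countᵇ p (oneTo n) ≡ countᵇ q (oneTo n)
countᵇ-cong-oneTo p q n h =
  N.countᵇ-cong-mem p q (oneTo n) (λ j m → h j (proj₁ (mem-oneTo⁻ n j m)) (proj₂ (mem-oneTo⁻ n j m)))

+-swapʳ : ∀ a b c → a + b + c ≡ a + c + b
+-swapʳ a b c = trans (+-assoc a b c) (trans (cong (a +_) (+-comm b c)) (sym (+-assoc a c b)))

countᵇ-oneTo-update : ∀ (p q : ℕ → Bool) n a → 1 ≤ a → a ≤ n → (∀ j → 1 ≤ j → j ≤ n → j ≢ a → p j ≡ q j) →
  countᵇ p (oneTo n) + ⟦ q a ⟧ ≡ countᵇ q (oneTo n) + ⟦ p a ⟧
countᵇ-oneTo-update p q zero a h₁ h₂ h = ⊥-elim (1+n≰n (≤-trans h₁ h₂))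
countᵇ-oneTo-update p q (suc n) a h₁ h₂ h
  rewrite countᵇ-oneTo-suc p n | countᵇ-oneTo-suc q n with m≤n⇒m<n∨m≡n h₂
... | inj₂ refl rewrite countᵇ-cong-oneTo p q n (λ j a′ b → h j a′ (m≤n⇒m≤1+n b) (λ { refl → 1+n≰n b })) =
  +-swapʳ (countᵇ q (oneTo n)) _ _
... | inj₁ lt rewrite h (suc n) (s≤s z≤n) ≤-refl (λ { refl → 1+n≰n (≤-pred lt) }) =
  trans (+-swapʳ (countᵇ p (oneTo n)) _ _)
    (trans (cong (_+ ⟦ q (suc n) ⟧) (countᵇ-oneTo-update p q n a h₁ (≤-pred lt) (λ j a′ b → h j a′ (m≤n⇒m≤1+n b))))
      (+-swapʳ (countᵇ q (oneTo n)) _ _))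

mem-insertions⁻ : ∀ x u w → L.mem w (insertions x u) ≡ true →
  length w ≡ suc (length u) × (∀ j → N.mem j w ≡ (j ≡ᵇ x) ∨ N.mem j u)
mem-insertions⁻ x [] w h with L.mem-∷ {w} {x ∷ []} {[]} h
... | inj₁ refl = refl , (λ j → refl)
mem-insertions⁻ x (y ∷ ys) w h with L.mem-∷ {w} {x ∷ y ∷ ys} {map (y ∷_) (insertions x ys)} h
... | inj₁ refl = refl , (λ j → refl)
... | inj₂ m with L.mem-map⁻ w (y ∷_) (insertions x ys) m
...   | (w′ , m₁ , refl) with mem-insertions⁻ x ys w′ m₁
...     | (len , mem≡) = cong suc len ,
          (λ j → trans (cong ((j ≡ᵇ y) ∨_) (mem≡ j)) (∨-left-comm (j ≡ᵇ y) (j ≡ᵇ x) (N.mem j ys)))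

remove-mem-insertions : ∀ x u w → N.mem x u ≡ false → L.mem w (insertions x u) ≡ true → N.remove x w ≡ u
remove-mem-insertions x [] w x∉u h with L.mem-∷ {w} {x ∷ []} {[]} h
... | inj₁ refl rewrite ≡ᵇ-refl x = refl
remove-mem-insertions x (y ∷ ys) w x∉u h with L.mem-∷ {w} {x ∷ y ∷ ys} {map (y ∷_) (insertions x ys)} h
... | inj₁ refl rewrite ≡ᵇ-refl x = refl
... | inj₂ m with L.mem-map⁻ w (y ∷_) (insertions x ys) m
...   | (w′ , m₁ , refl) with N.¬mem-∷ {x} {y} {ys} x∉u
...     | (x≢y , x∉ys) rewrite N.≢⇒==-false x≢y = cong (y ∷_) (remove-mem-insertions x ys w′ x∉ys m₁)

nodup-insertions : ∀ x u → N.mem x u ≡ false → L.Nodup (insertions x u)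
nodup-insertions x [] _ = refl L.∷ₙ L.[]ₙ
nodup-insertions x (y ∷ ys) x∉u with N.¬mem-∷ {x} {y} {ys} x∉u
... | (x≢y , x∉ys) =
  ≢true⇒≡false (λ m → let (_ , _ , e) = L.mem-map⁻ (x ∷ y ∷ ys) (y ∷_) (insertions x ys) m in x≢y (sym (∷-injectiveˡ e)))
  L.∷ₙ L.nodup-map (y ∷_) (insertions x ys) (nodup-insertions x ys x∉ys) (λ _ _ _ _ → ∷-injectiveʳ)

mem-insertions-remove : ∀ x w → N.mem x w ≡ true → L.mem w (insertions x (N.remove x w)) ≡ true
mem-insertions-remove x [] ()
mem-insertions-remove x (y ∷ ys) h with x ≡ᵇ y in e
... | true rewrite ≡ᵇ⇒≡′ {x} {y} e = insertions-head y ys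
  where
    insertions-head : ∀ x ys → L.mem (x ∷ ys) (insertions x ys) ≡ true
    insertions-head x [] = L.mem-here (x ∷ []) []
    insertions-head x (z ∷ zs) = L.mem-here (x ∷ z ∷ zs) (map (z ∷_) (insertions x zs))
... | false =
  L.mem-there (y ∷ ys) (x ∷ y ∷ N.remove x ys) (map (y ∷_) (insertions x (N.remove x ys)))
    (L.mem-map⁺ (y ∷_) ys (insertions x (N.remove x ys)) (mem-insertions-remove x ys h))

record IsPermutation (n : ℕ) (u : List ℕ) : Set where
  field
    length≡ : length u ≡ n
    nodup : N.Nodup u
    bounded : ∀ j → N.mem j u ≡ true → 1 ≤ j × j ≤ n
    covers : ∀ j → 1 ≤ j → j ≤ n → N.mem j u ≡ true

suc∉permutation : ∀ n u → IsPermutation n u → N.mem (suc n) u ≡ false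
suc∉permutation n u P = ≢true⇒≡false (λ m → 1+n≰n (proj₂ (IsPermutation.bounded P (suc n) m)))

nodup-mem-insertions : ∀ x u w → N.mem x u ≡ false → N.Nodup u → L.mem w (insertions x u) ≡ true → N.Nodup w
nodup-mem-insertions x [] w x∉u nd h with L.mem-∷ {w} {x ∷ []} {[]} h
... | inj₁ refl = refl N.∷ₙ N.[]ₙ
nodup-mem-insertions x (y ∷ ys) w x∉u nd h with L.mem-∷ {w} {x ∷ y ∷ ys} {map (y ∷_) (insertions x ys)} h
... | inj₁ refl = x∉u N.∷ₙ nd
nodup-mem-insertions x (y ∷ ys) w x∉u (y∉ys N.∷ₙ nd) h | inj₂ m with L.mem-map⁻ w (y ∷_) (insertions x ys) m
...   | (w′ , m₁ , refl) with N.¬mem-∷ {x} {y} {ys} x∉u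
...     | (x≢y , x∉ys) =
  trans (proj₂ (mem-insertions⁻ x ys w′ m₁) y) (cong₂ _∨_ (N.≢⇒==-false (λ e → x≢y (sym e))) y∉ys)
  N.∷ₙ nodup-mem-insertions x ys w′ x∉ys nd m₁

mem-perms⇒IsPermutation : ∀ n u → L.mem u (perms n) ≡ true → IsPermutation n u
mem-perms⇒IsPermutation zero u h with L.mem-∷ {u} {[]} {[]} h
... | inj₁ refl = record
  { length≡ = refl ; nodup = N.[]ₙ ; bounded = λ j () ; covers = λ j a b → ⊥-elim (1+n≰n (≤-trans a b)) }
mem-perms⇒IsPermutation (suc n) w h with L.mem-concatMap⁻ w (insertions (suc n)) (perms n) h
... | (u , m₁ , m₂) = record
  { length≡ = trans (proj₁ (mem-insertions⁻ (suc n) u w m₂)) (cong suc (IsPermutation.length≡ P))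
  ; nodup = nodup-mem-insertions (suc n) u w (suc∉permutation n u P) (IsPermutation.nodup P) m₂
  ; bounded = λ j m → bounded j (trans (sym (mem-w j)) m)
  ; covers = λ j a b → trans (mem-w j) (covers j a b) }
  where
    P = mem-perms⇒IsPermutation n u m₁
    mem-w = proj₂ (mem-insertions⁻ (suc n) u w m₂)
    bounded : ∀ j → (j ≡ᵇ suc n) ∨ N.mem j u ≡ true → 1 ≤ j × j ≤ suc n
    bounded j e with ∨-true {j ≡ᵇ suc n} e
    ... | inj₁ e₁ rewrite ≡ᵇ⇒≡′ {j} {suc n} e₁ = s≤s z≤n , ≤-refl
    ... | inj₂ e₂ = proj₁ (IsPermutation.bounded P j e₂) , m≤n⇒m≤1+n (proj₂ (IsPermutation.bounded P j e₂))
    covers : ∀ j → 1 ≤ j → j ≤ suc n → (j ≡ᵇ suc n) ∨ N.mem j u ≡ true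
    covers j a b with m≤n⇒m<n∨m≡n b
    ... | inj₁ lt rewrite IsPermutation.covers P j a (≤-pred lt) = ∨-zeroʳ _
    ... | inj₂ refl rewrite ≡ᵇ-refl (suc n) = refl

nodup-perms : ∀ n → L.Nodup (perms n)
nodup-perms zero = refl L.∷ₙ L.[]ₙ
nodup-perms (suc n) = L.nodup-concatMap (insertions (suc n)) (N.remove (suc n)) (perms n) (nodup-perms n)
  (λ u m → nodup-insertions (suc n) u (suc∉permutation n u (mem-perms⇒IsPermutation n u m)))
  (λ u w m₁ m₂ → remove-mem-insertions (suc n) u w (suc∉permutation n u (mem-perms⇒IsPermutation n u m₁)) m₂)

isPerm⇒mem-perms : ∀ n w → isPerm n w ≡ true → L.mem w (perms n) ≡ true
isPerm⇒mem-perms zero [] h = refl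
isPerm⇒mem-perms (suc n) w h =
  L.mem-concatMap⁺ w (insertions (suc n)) (perms n) u
    (isPerm⇒mem-perms n u (∧-true (T⇒≡true (≡⇒≡ᵇ (length u) n length-u)) (all-oneTo⁺ _ n covers-u)))
    (mem-insertions-remove (suc n) w (covers-w (suc n) (s≤s z≤n) ≤-refl))
  where
    covers-w : ∀ j → 1 ≤ j → j ≤ suc n → N.mem j w ≡ true
    covers-w j a b = trans (sym (elem≡mem j w)) (all-oneTo⁻ (λ j → elem j w) (suc n) (∧-trueʳ h) j a b)
    u = N.remove (suc n) w
    length-u : length u ≡ n
    length-u = suc-injective (trans (sym (N.length-remove (suc n) w (covers-w (suc n) (s≤s z≤n) ≤-refl)))
                                    (≡ᵇ⇒≡′ (∧-trueˡ h)))
    covers-u : ∀ j → 1 ≤ j → j ≤ n → elem j u ≡ true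
    covers-u j a b = trans (elem≡mem j u)
      (N.mem-remove j (suc n) w (covers-w j a (m≤n⇒m≤1+n b)) (λ { refl → 1+n≰n b }))

mem-perms⇒isPerm : ∀ n w → L.mem w (perms n) ≡ true → isPerm n w ≡ true
mem-perms⇒isPerm n w h = ∧-true (T⇒≡true (≡⇒≡ᵇ (length w) n (IsPermutation.length≡ P)))
  (all-oneTo⁺ _ n (λ j a b → trans (elem≡mem j w) (IsPermutation.covers P j a b)))
  where P = mem-perms⇒IsPermutation n w h

isPerm≡mem-perms : ∀ n w → isPerm n w ≡ L.mem w (perms n)
isPerm≡mem-perms n w with isPerm n w in e₁ | L.mem w (perms n) in e₂
... | true | true = refl
... | false | false = refl
... | true | false = ⊥-elim (true≢false (trans (sym (isPerm⇒mem-perms n w e₁)) e₂))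
... | false | true = ⊥-elim (true≢false (trans (sym (mem-perms⇒isPerm n w e₂)) e₁))

-- The common recurrence: a permutation with statistic d has d+1 extensions keeping the
-- statistic and b extensions raising it; children d k b counts those with statistic k.

children : ℕ → ℕ → ℕ → ℕ
children d k b = ⟦ d ≡ᵇ k ⟧ * suc d + ⟦ suc d ≡ᵇ k ⟧ * b

weight : ℕ → ℕ → ℕ → ℕ
weight n d k = children d k (n ∸ (d + d))

children-extra : ∀ c d k b → ⟦ c ∧ (suc d ≡ᵇ k) ⟧ + children d k b ≡ children d k (b + ⟦ c ⟧)
children-extra true d k b = identity ⟦ suc d ≡ᵇ k ⟧ (⟦ d ≡ᵇ k ⟧ * suc d) b
  where
    identity : ∀ i a b → i + (a + i * b) ≡ a + i * (b + 1)
    identity = solve-∀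
children-extra false d k b = identity (⟦ d ≡ᵇ k ⟧ * suc d) b ⟦ suc d ≡ᵇ k ⟧
  where
    identity : ∀ a b i → 0 + (a + i * b) ≡ a + i * (b + 0)
    identity = solve-∀

children-suc : ∀ d k b → ⟦ d ≡ᵇ k ⟧ + children d k b ≡ children (suc d) (suc k) b
children-suc d k b = identity ⟦ d ≡ᵇ k ⟧ d ⟦ suc d ≡ᵇ k ⟧ b
  where
    identity : ∀ i d j b → i + (i * suc d + j * b) ≡ i * suc (suc d) + j * b
    identity = solve-∀

children-[] : ∀ k → ⟦ 0 ≡ᵇ k ⟧ + 0 ≡ children 0 k 0
children-[] k = identity ⟦ 0 ≡ᵇ k ⟧ ⟦ 1 ≡ᵇ k ⟧
  where
    identity : ∀ a b → a + 0 ≡ a * 1 + b * 0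
    identity = solve-∀

headBelow : ℕ → List ℕ → Bool
headBelow z [] = false
headBelow z (y ∷ _) = y <ᵇ z

-- The slots strictly after z in z ∷ ys at which a new largest letter raises des without
-- creating a double descent.
descentSlotsAfter : ℕ → List ℕ → ℕ
descentSlotsAfter z [] = 0
descentSlotsAfter z (y ∷ ys) =
  if y <ᵇ z then descentSlotsAfter y ys else descentSlotsAfter y ys + ⟦ not (headBelow y ys) ⟧

descentSlots : List ℕ → ℕ
descentSlots [] = 0
descentSlots (z ∷ ys) = descentSlotsAfter z ys + ⟦ not (headBelow z ys) ⟧

noDoubleDescent-descent : ∀ x y ys → y < x →
  noDoubleDescent (x ∷ y ∷ ys) ≡ not (headBelow y ys) ∧ noDoubleDescent (y ∷ ys)
noDoubleDescent-descent x y [] lt = refl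
noDoubleDescent-descent x y (c ∷ cs) lt rewrite <ᵇ-true lt = refl

noDoubleDescent-tail : ∀ z ys → noDoubleDescent (z ∷ ys) ≡ true → noDoubleDescent ys ≡ true
noDoubleDescent-tail z [] h = refl
noDoubleDescent-tail z (y ∷ []) h = refl
noDoubleDescent-tail z (y ∷ c ∷ cs) h = ∧-trueʳ h

noDoubleDescent⇒¬headBelow : ∀ z y ys → (y <ᵇ z) ≡ true → noDoubleDescent (z ∷ y ∷ ys) ≡ true →
  headBelow y ys ≡ false
noDoubleDescent⇒¬headBelow z y [] e h = refl
noDoubleDescent⇒¬headBelow z y (c ∷ cs) e h rewrite e with c <ᵇ y
... | true = ⊥-elim (true≢false (sym (∧-trueˡ {b = noDoubleDescent (y ∷ c ∷ cs)} h)))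
... | false = refl

insertions-head : ∀ x ys w → L.mem w (insertions x ys) ≡ true →
  Σ ℕ (λ h → Σ (List ℕ) (λ t → w ≡ h ∷ t × (h ≡ x ⊎ Σ (List ℕ) (λ cs → ys ≡ h ∷ cs))))
insertions-head x [] w m with L.mem-∷ {w} {x ∷ []} {[]} m
... | inj₁ refl = x , [] , refl , inj₁ refl
insertions-head x (c ∷ cs) w m with L.mem-∷ {w} {x ∷ c ∷ cs} {map (c ∷_) (insertions x cs)} m
... | inj₁ refl = x , c ∷ cs , refl , inj₁ refl
... | inj₂ m′ with L.mem-map⁻ w (c ∷_) (insertions x cs) m′
...   | (w′ , _ , refl) = c , w′ , refl , inj₂ (cs , refl)

NoDDWithDes : ℕ → List ℕ → Bool
NoDDWithDes k w = noDoubleDescent w ∧ (des w ≡ᵇ k)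

module _ (x : ℕ) where

  insert-after-head : ∀ z y ys k → z < x → y < x → noDoubleDescent (y ∷ ys) ≡ true →
    NoDDWithDes k (z ∷ x ∷ y ∷ ys) ≡ not (headBelow y ys) ∧ (suc (des (y ∷ ys)) ≡ᵇ k)
  insert-after-head z y ys k z<x y<x nd
    rewrite <ᵇ-false (<⇒≤ z<x) | <ᵇ-true y<x | noDoubleDescent-descent x y ys y<x | nd
          | ∧-identityʳ (not (headBelow y ys)) = refl

  prefix-ascent : ∀ z y k → (y <ᵇ z) ≡ false → ∀ w → NoDDWithDes k (z ∷ y ∷ w) ≡ NoDDWithDes k (y ∷ w)
  prefix-ascent z y k e [] rewrite e = refl
  prefix-ascent z y k e (_ ∷ _) rewrite e = refl

  -- The letter after y is x or the head of ys, and neither is below y.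
  prefix-descent : ∀ z y ys k → y < x → (y <ᵇ z) ≡ true → noDoubleDescent (z ∷ y ∷ ys) ≡ true →
    ∀ w → L.mem w (insertions x ys) ≡ true →
    NoDDWithDes k (z ∷ y ∷ w) ≡ noDoubleDescent (y ∷ w) ∧ (suc (des (y ∷ w)) ≡ᵇ k)
  prefix-descent z y ys k y<x y<z nd w m with insertions-head x ys w m
  ... | (h , t , refl , inj₁ refl) rewrite y<z | <ᵇ-false (<⇒≤ y<x) = refl
  ... | (h , t , refl , inj₂ (cs , refl)) = after-descent (noDoubleDescent⇒¬headBelow z y (h ∷ cs) y<z nd)
    where
      after-descent : (h <ᵇ y) ≡ false →
        NoDDWithDes k (z ∷ y ∷ h ∷ t) ≡ noDoubleDescent (y ∷ h ∷ t) ∧ (suc (des (y ∷ h ∷ t)) ≡ᵇ k)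
      after-descent e rewrite y<z | e = refl

  countᵇ-insertions-after : ∀ z ys → All (_< x) (z ∷ ys) → noDoubleDescent (z ∷ ys) ≡ true → ∀ k →
    countᵇ (λ w → NoDDWithDes k (z ∷ w)) (insertions x ys) ≡ children (des (z ∷ ys)) k (descentSlotsAfter z ys)
  countᵇ-insertions-after z [] (z<x ∷ []) nd k rewrite <ᵇ-false (<⇒≤ z<x) = children-[] k
  countᵇ-insertions-after z (y ∷ ys) (z<x ∷ y<x ∷ ys<x) nd k =
    trans (cong₂ _+_ (cong ⟦_⟧ (insert-after-head z y ys k z<x y<x nd′))
                     (countᵇ-map (λ w → NoDDWithDes k (z ∷ w)) (y ∷_) (insertions x ys)))
          (by-step (y <ᵇ z) refl k)
    where
      nd′ = noDoubleDescent-tail z (y ∷ ys) nd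
      by-step : ∀ b → (y <ᵇ z) ≡ b → ∀ k →
        ⟦ not (headBelow y ys) ∧ (suc (des (y ∷ ys)) ≡ᵇ k) ⟧
          + countᵇ (λ w → NoDDWithDes k (z ∷ y ∷ w)) (insertions x ys)
        ≡ children (des (z ∷ y ∷ ys)) k (descentSlotsAfter z (y ∷ ys))
      by-step false e k rewrite countᵇ-cong _ _ (insertions x ys) (prefix-ascent z y k e)
                              | countᵇ-insertions-after y ys (y<x ∷ ys<x) nd′ k | e =
        children-extra (not (headBelow y ys)) (des (y ∷ ys)) k (descentSlotsAfter y ys)
      by-step true e k rewrite L.countᵇ-cong-mem _ _ (insertions x ys) (prefix-descent z y ys k y<x e nd)
                             | e | noDoubleDescent⇒¬headBelow z y ys e nd with k
      ... | zero rewrite countᵇ-cong (λ w → noDoubleDescent (y ∷ w) ∧ (suc (des (y ∷ w)) ≡ᵇ 0)) (λ _ → false)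
                                     (insertions x ys) (λ w → ∧-zeroʳ _)
                       | countᵇ-false (insertions x ys) = refl
      ... | suc k′ rewrite countᵇ-insertions-after y ys (y<x ∷ ys<x) nd′ k′ =
        children-suc (des (y ∷ ys)) k′ (descentSlotsAfter y ys)

  countᵇ-insertions : ∀ u → All (_< x) u → noDoubleDescent u ≡ true → ∀ k →
    countᵇ (NoDDWithDes k) (insertions x u) ≡ children (des u) k (descentSlots u)
  countᵇ-insertions [] [] nd k = children-[] k
  countᵇ-insertions (z ∷ ys) (z<x ∷ ys<x) nd k =
    trans (cong₂ _+_ (cong ⟦_⟧ insert-in-front) (countᵇ-map (NoDDWithDes k) (z ∷_) (insertions x ys)))
      (trans (cong (⟦ not (headBelow z ys) ∧ (suc (des (z ∷ ys)) ≡ᵇ k) ⟧ +_)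
                   (countᵇ-insertions-after z ys (z<x ∷ ys<x) nd k))
             (children-extra (not (headBelow z ys)) (des (z ∷ ys)) k (descentSlotsAfter z ys)))
    where
      insert-in-front : NoDDWithDes k (x ∷ z ∷ ys) ≡ not (headBelow z ys) ∧ (suc (des (z ∷ ys)) ≡ᵇ k)
      insert-in-front rewrite noDoubleDescent-descent x z ys z<x | nd | <ᵇ-true z<x
                            | ∧-identityʳ (not (headBelow z ys)) = refl

descentSlotsAfter-length : ∀ z ys → noDoubleDescent (z ∷ ys) ≡ true →
  descentSlotsAfter z ys + (des (z ∷ ys) + des (z ∷ ys)) + ⟦ not (headBelow z ys) ⟧ ≡ suc (length ys)
descentSlotsAfter-length z [] nd = refl
descentSlotsAfter-length z (y ∷ ys) nd with y <ᵇ z in e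
... | true =
  trans (identity (descentSlotsAfter y ys) (des (y ∷ ys)))
        (cong suc (trans (cong (λ t → descentSlotsAfter y ys + (des (y ∷ ys) + des (y ∷ ys)) + ⟦ not t ⟧)
                               (sym (noDoubleDescent⇒¬headBelow z y ys e nd)))
                         (descentSlotsAfter-length y ys (noDoubleDescent-tail z (y ∷ ys) nd))))
  where
    identity : ∀ b d → b + (suc d + suc d) + 0 ≡ suc (b + (d + d) + 1)
    identity = solve-∀
... | false =
  trans (identity (descentSlotsAfter y ys) ⟦ not (headBelow y ys) ⟧ (des (y ∷ ys)))
        (cong suc (descentSlotsAfter-length y ys (noDoubleDescent-tail z (y ∷ ys) nd)))
  where
    identity : ∀ b i d → b + i + (d + d) + 1 ≡ suc (b + (d + d) + i)
    identity = solve-∀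

-- Of the length u + 1 slots, des u + 1 keep des, descentSlots u raise it, and the
-- remaining des u create a double descent.
descentSlots+2des≡length : ∀ u → noDoubleDescent u ≡ true → descentSlots u + (des u + des u) ≡ length u
descentSlots+2des≡length [] nd = refl
descentSlots+2des≡length (z ∷ ys) nd =
  trans (+-swapʳ (descentSlotsAfter z ys) ⟦ not (headBelow z ys) ⟧ (des (z ∷ ys) + des (z ∷ ys)))
        (descentSlotsAfter-length z ys nd)

-- Simsun permutations of [n+1] are insertions of n+1 into simsun permutations of [n]

all-mem : ∀ (P : ℕ → Set) w → (∀ j → N.mem j w ≡ true → P j) → All P w
all-mem P [] h = []
all-mem P (y ∷ w) h = h y (N.mem-here y w) ∷ all-mem P w (λ j m → h j (N.mem-there j y w m))

filterᵇ-all : ∀ (q : ℕ → Bool) w → All (λ y → q y ≡ true) w → filterᵇ q w ≡ w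
filterᵇ-all q [] [] = refl
filterᵇ-all q (y ∷ w) (e ∷ al) rewrite filterᵇ-∷ q y w | e = cong (y ∷_) (filterᵇ-all q w al)

restrictTo-bounded : ∀ n w → (∀ j → N.mem j w ≡ true → j ≤ n) → restrictTo n w ≡ w
restrictTo-bounded n w h = filterᵇ-all (λ y → y ≤ᵇ n) w (all-mem _ w (λ j m → ≤ᵇ-true (h j m)))

restrictTo-insertions : ∀ x u w → L.mem w (insertions x u) ≡ true → ∀ j → j < x → restrictTo j w ≡ restrictTo j u
restrictTo-insertions x [] w h j j<x with L.mem-∷ {w} {x ∷ []} {[]} h
... | inj₁ refl rewrite filterᵇ-∷ (_≤ᵇ j) x [] | ≤ᵇ-false j<x = refl
restrictTo-insertions x (y ∷ ys) w h j j<x with L.mem-∷ {w} {x ∷ y ∷ ys} {map (y ∷_) (insertions x ys)} h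
... | inj₁ refl rewrite filterᵇ-∷ (_≤ᵇ j) x (y ∷ ys) | ≤ᵇ-false j<x = refl
... | inj₂ m with L.mem-map⁻ w (y ∷_) (insertions x ys) m
...   | (w′ , m₁ , refl) rewrite filterᵇ-∷ (_≤ᵇ j) y w′ | filterᵇ-∷ (_≤ᵇ j) y ys
                                | restrictTo-insertions x ys w′ m₁ j j<x = refl

bounded-insertions : ∀ n u w → IsPermutation n u → L.mem w (insertions (suc n) u) ≡ true →
  ∀ j → N.mem j w ≡ true → j ≤ suc n
bounded-insertions n u w P m j j∈w with ∨-true {j ≡ᵇ suc n} (trans (sym (proj₂ (mem-insertions⁻ (suc n) u w m) j)) j∈w)
... | inj₁ e = ≤-reflexive (≡ᵇ⇒≡′ e)
... | inj₂ e = m≤n⇒m≤1+n (proj₂ (IsPermutation.bounded P j e))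

isSimsun-insertions : ∀ n u w → IsPermutation n u → L.mem w (insertions (suc n) u) ≡ true →
  isSimsun w ≡ isSimsun u ∧ noDoubleDescent w
isSimsun-insertions n u w P m
  rewrite proj₁ (mem-insertions⁻ (suc n) u w m) | IsPermutation.length≡ P
        | all-snoc (λ k → noDoubleDescent (restrictTo k w)) (oneTo n) (suc n)
        | all-cong-oneTo (λ k → noDoubleDescent (restrictTo k w)) (λ k → noDoubleDescent (restrictTo k u)) n
            (λ j _ j≤n → cong noDoubleDescent (restrictTo-insertions (suc n) u w m j (s≤s j≤n)))
        | restrictTo-bounded (suc n) w (bounded-insertions n u w P m)
        | restrictTo-insertions (suc n) u w m 0 (s≤s z≤n)
  = sym (∧-assoc (noDoubleDescent (restrictTo 0 u)) _ _)

isSimsun⇒noDoubleDescent : ∀ n u → IsPermutation n u → isSimsun u ≡ true → noDoubleDescent u ≡ true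
isSimsun⇒noDoubleDescent zero [] P h = refl
isSimsun⇒noDoubleDescent zero (x ∷ u) P h with IsPermutation.length≡ P
... | ()
isSimsun⇒noDoubleDescent (suc n) u P h =
  trans (cong noDoubleDescent (sym (restrictTo-bounded (suc n) u (λ j m → proj₂ (IsPermutation.bounded P j m)))))
    (all-oneTo⁻ (λ k → noDoubleDescent (restrictTo k u)) (suc n)
      (subst (λ l → all (λ k → noDoubleDescent (restrictTo k u)) (oneTo l) ≡ true) (IsPermutation.length≡ P) (∧-trueʳ h))
      (suc n) (s≤s z≤n) ≤-refl)

countᵇ-simsun-insertions : ∀ n u → IsPermutation n u → ∀ k →
  countᵇ (λ w → isSimsun w ∧ (des w ≡ᵇ k)) (insertions (suc n) u) ≡ (if isSimsun u then weight n (des u) k else 0)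
countᵇ-simsun-insertions n u P k with isSimsun u in simsun-u
... | false =
  trans (L.countᵇ-cong-mem _ _ (insertions (suc n) u)
          (λ w m → cong (_∧ (des w ≡ᵇ k)) (trans (isSimsun-insertions n u w P m) (cong (_∧ noDoubleDescent w) simsun-u))))
        (countᵇ-false (insertions (suc n) u))
... | true =
  trans (L.countᵇ-cong-mem _ (NoDDWithDes k) (insertions (suc n) u)
          (λ w m → cong (_∧ (des w ≡ᵇ k)) (trans (isSimsun-insertions n u w P m) (cong (_∧ noDoubleDescent w) simsun-u))))
        (trans (countᵇ-insertions (suc n) u (all-mem _ u (λ j m → s≤s (proj₂ (IsPermutation.bounded P j m)))) nd k)
               (cong (children (des u) k) slots≡))
  where
    nd = isSimsun⇒noDoubleDescent n u P simsun-u
    slots≡ : descentSlots u ≡ n ∸ (des u + des u)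
    slots≡ = sym (trans (cong (_∸ (des u + des u)) (trans (sym (IsPermutation.length≡ P)) (sym (descentSlots+2des≡length u nd))))
                        (m+n∸n≡m (descentSlots u) (des u + des u)))

setAt : ℕ → ℕ → List ℕ → List ℕ
setAt _ m [] = []
setAt zero m (x ∷ xs) = x ∷ xs
setAt (suc zero) m (x ∷ xs) = m ∷ xs
setAt (suc (suc a)) m (x ∷ xs) = x ∷ setAt (suc a) m xs

length-setAt : ∀ a m u → length (setAt a m u) ≡ length u
length-setAt a m [] = refl
length-setAt zero m (x ∷ u) = refl
length-setAt (suc zero) m (x ∷ u) = refl
length-setAt (suc (suc a)) m (x ∷ u) = cong suc (length-setAt (suc a) m u)

at-++ : ∀ xs ys i → i ≤ length xs → at (xs ++ ys) i ≡ at xs i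
at-++ [] [] zero le = refl
at-++ [] (y ∷ ys) zero le = refl
at-++ [] ys (suc i) ()
at-++ (x ∷ xs) ys zero le = refl
at-++ (x ∷ xs) ys (suc zero) le = refl
at-++ (x ∷ xs) ys (suc (suc i)) (s≤s le) = at-++ xs ys (suc i) le

at-last : ∀ xs y → at (xs ++ y ∷ []) (suc (length xs)) ≡ y
at-last [] y = refl
at-last (x ∷ []) y = refl
at-last (x ∷ x′ ∷ xs) y = at-last (x′ ∷ xs) y

at-setAt : ∀ a m u i → 1 ≤ i → i ≤ length u → 1 ≤ a → at (setAt a m u) i ≡ (if i ≡ᵇ a then m else at u i)
at-setAt a m [] (suc i) h₁ () h₂
at-setAt (suc zero) m (x ∷ u) (suc zero) h₁ h₃ h₂ = refl
at-setAt (suc zero) m (x ∷ u) (suc (suc i)) h₁ h₃ h₂ = refl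
at-setAt (suc (suc a)) m (x ∷ u) (suc zero) h₁ h₃ h₂ = refl
at-setAt (suc (suc a)) m (x ∷ u) (suc (suc i)) h₁ (s≤s h₃) h₂ = at-setAt (suc a) m u (suc i) (s≤s z≤n) h₃ (s≤s z≤n)

at-mem : ∀ u i → 1 ≤ i → i ≤ length u → N.mem (at u i) u ≡ true
at-mem (x ∷ u) (suc zero) h₁ h₂ = N.mem-here x u
at-mem (x ∷ u) (suc (suc i)) h₁ (s≤s h₂) = N.mem-there _ x u (at-mem u (suc i) (s≤s z≤n) h₂)

at-injective : ∀ u → N.Nodup u → ∀ i j → 1 ≤ i → i ≤ length u → 1 ≤ j → j ≤ length u → at u i ≡ at u j → i ≡ j
at-injective (x ∷ u) _ (suc zero) (suc zero) _ _ _ _ e = refl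
at-injective (x ∷ u) (nx N.∷ₙ nd) (suc zero) (suc (suc j)) _ _ _ (s≤s b) e =
  ⊥-elim (N.mem-≢ u (at-mem u (suc j) (s≤s z≤n) b) nx (sym e))
at-injective (x ∷ u) (nx N.∷ₙ nd) (suc (suc i)) (suc zero) _ (s≤s b) _ _ e =
  ⊥-elim (N.mem-≢ u (at-mem u (suc i) (s≤s z≤n) b) nx e)
at-injective (x ∷ u) (nx N.∷ₙ nd) (suc (suc i)) (suc (suc j)) _ (s≤s b₁) _ (s≤s b₂) e =
  cong suc (at-injective u nd (suc i) (suc j) (s≤s z≤n) b₁ (s≤s z≤n) b₂ e)

dropLast-snoc : ∀ xs y → dropLast (xs ++ y ∷ []) ≡ xs
dropLast-snoc [] y = refl
dropLast-snoc (x ∷ []) y = refl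
dropLast-snoc (x ∷ x′ ∷ xs) y = cong (x ∷_) (dropLast-snoc (x′ ∷ xs) y)

replaceVal-∉ : ∀ m b u → N.mem m u ≡ false → replaceVal m b u ≡ u
replaceVal-∉ m b [] h = refl
replaceVal-∉ m b (x ∷ u) h with N.¬mem-∷ {m} {x} {u} h
... | (ne , h′) rewrite N.≢⇒==-false {x} {m} (λ e → ne (sym e)) = cong (x ∷_) (replaceVal-∉ m b u h′)

replaceVal-setAt : ∀ m a u → N.mem m u ≡ false → 1 ≤ a → a ≤ length u → replaceVal m (at u a) (setAt a m u) ≡ u
replaceVal-setAt m (suc zero) (x ∷ u) h _ _ rewrite ≡ᵇ-refl m = cong (x ∷_) (replaceVal-∉ m x u (proj₂ (N.¬mem-∷ {m} {x} {u} h)))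
replaceVal-setAt m (suc (suc a)) (x ∷ u) h _ (s≤s b) with N.¬mem-∷ {m} {x} {u} h
... | (ne , h′) rewrite N.≢⇒==-false {x} {m} (λ e → ne (sym e)) = cong (x ∷_) (replaceVal-setAt m (suc a) u h′ (s≤s z≤n) b)

mem-setAt-new : ∀ a m u → 1 ≤ a → a ≤ length u → N.mem m (setAt a m u) ≡ true
mem-setAt-new (suc zero) m (x ∷ u) _ _ = N.mem-here m u
mem-setAt-new (suc (suc a)) m (x ∷ u) _ (s≤s b) = N.mem-there m x (setAt (suc a) m u) (mem-setAt-new (suc a) m u (s≤s z≤n) b)

mem-setAt-old : ∀ a m u j → N.mem j u ≡ true → j ≢ at u a → 1 ≤ a → a ≤ length u → N.mem j (setAt a m u) ≡ true
mem-setAt-old (suc zero) m (x ∷ u) j h ne _ _ with N.mem-∷ {j} {x} {u} h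
... | inj₁ e = ⊥-elim (ne e)
... | inj₂ h′ = N.mem-there j m u h′
mem-setAt-old (suc (suc a)) m (x ∷ u) j h ne _ (s≤s b) with N.mem-∷ {j} {x} {u} h
... | inj₁ refl = N.mem-here j (setAt (suc a) m u)
... | inj₂ h′ = N.mem-there j x (setAt (suc a) m u) (mem-setAt-old (suc a) m u j h′ ne (s≤s z≤n) b)

mem-map-ℕ⁻ : ∀ (f : ℕ → List ℕ) xs z → L.mem z (map f xs) ≡ true → Σ ℕ (λ a → N.mem a xs ≡ true × f a ≡ z)
mem-map-ℕ⁻ f [] z ()
mem-map-ℕ⁻ f (x ∷ xs) z h with L.mem-∷ {z} {f x} {map f xs} h
... | inj₁ e = x , N.mem-here x xs , sym e
... | inj₂ m with mem-map-ℕ⁻ f xs z m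
...   | (a , m₁ , e) = a , N.mem-there a x xs m₁ , e

nodup-map-ℕ : ∀ (f : ℕ → List ℕ) xs → N.Nodup xs → (∀ a b → N.mem a xs ≡ true → N.mem b xs ≡ true → f a ≡ f b → a ≡ b) → L.Nodup (map f xs)
nodup-map-ℕ f [] nd h = L.[]ₙ
nodup-map-ℕ f (x ∷ xs) (nx N.∷ₙ nd) h =
  ≢true⇒≡false (λ m → let (b , m₁ , e) = mem-map-ℕ⁻ f xs (f x) m in
     N.mem-≢ xs m₁ nx (h b x (N.mem-there b x xs m₁) (N.mem-here x xs) e))
  L.∷ₙ nodup-map-ℕ f xs nd (λ a b ma mb → h a b (N.mem-there a x xs ma) (N.mem-there b x xs mb))

excFrom≡countᵇ : ∀ s w → excFrom (suc s) w ≡ countᵇ (λ i → (s + i) <ᵇ at w i) (oneTo (length w))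
excFrom≡countᵇ s [] = refl
excFrom≡countᵇ s (x ∷ xs) = sym (trans (countᵇ-oneTo-shift (λ i → (s + i) <ᵇ at (x ∷ xs) i) (length xs))
  (cong₂ _+_ (trans (cong (λ t → ⟦ t <ᵇ x ⟧) (trans (+-suc s 0) (cong suc (+-identityʳ s)))) (⟦⟧≡if (suc s <ᵇ x)))
    (trans (countᵇ-cong-oneTo _ _ (length xs) pw) (sym (excFrom≡countᵇ (suc s) xs)))))
  where
    pw : ∀ j → 1 ≤ j → j ≤ length xs → ((s + suc j) <ᵇ at (x ∷ xs) (suc j)) ≡ ((suc s + j) <ᵇ at xs j)
    pw (suc j) _ _ rewrite +-suc s (suc j) = refl

-- Simsun permutations of the second kind of [n+1] are extensions of those of [n]

isExcedance : List ℕ → ℕ → Bool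
isExcedance w i = i <ᵇ at w i

doubleExcAt : List ℕ → ℕ → Bool
doubleExcAt w i = (i <ᵇ at w i) ∧ (at w i <ᵇ at w (at w i))

exc≡countᵇ : ∀ w → exc w ≡ countᵇ (isExcedance w) (oneTo (length w))
exc≡countᵇ w = excFrom≡countᵇ 0 w

isExcedanceValue : List ℕ → ℕ → Bool
isExcedanceValue u a = any (λ i → (i <ᵇ a) ∧ (at u i ≡ᵇ a)) (oneTo (length u))

-- In cycle notation, insertAfter u a puts the new letter length u + 1 right after a in its
-- cycle; the first extension adds it as a fixed point.  removeLargest undoes both.
insertAfter : List ℕ → ℕ → List ℕ
insertAfter u a = setAt a (suc (length u)) u ++ at u a ∷ []

extensions : List ℕ → List (List ℕ)
extensions u = (u ++ suc (length u) ∷ []) ∷ map (insertAfter u) (oneTo (length u))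

length-extensions : ∀ u → length (extensions u) ≡ suc (length u)
length-extensions u = cong suc (trans (length-map (insertAfter u) (oneTo (length u))) (length-oneTo (length u)))

length-insertions : ∀ x u → length (insertions x u) ≡ suc (length u)
length-insertions x [] = refl
length-insertions x (y ∷ u) = cong suc (trans (length-map (y ∷_) (insertions x u)) (length-insertions x u))

isSimsun2-step : ∀ v u → length v ≡ suc (length u) → removeLargest v ≡ u →
  isSimsun2 v ≡ not (hasDoubleExc v) ∧ isSimsun2 u
isSimsun2-step v u len rem =
  trans (cong (λ t → noDExcAfterRemovals t v) len) (cong (λ w → not (hasDoubleExc v) ∧ noDExcAfterRemovals (length u) w) rem)

noDExcAfterRemovals⇒¬hasDoubleExc : ∀ f w → noDExcAfterRemovals f w ≡ true → hasDoubleExc w ≡ false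
noDExcAfterRemovals⇒¬hasDoubleExc zero w h with hasDoubleExc w
... | false = refl
noDExcAfterRemovals⇒¬hasDoubleExc (suc f) w h with hasDoubleExc w
... | false = refl

+⟦⟧≡+1 : ∀ x e b → x + ⟦ b ⟧ ≡ e + 1 → x ≡ (if b then e else suc e)
+⟦⟧≡+1 x e true h = +-cancelʳ-≡ 1 x e h
+⟦⟧≡+1 x e false h = trans (sym (+-identityʳ x)) (trans h (+-comm e 1))

module Extension (u : List ℕ) (P : IsPermutation (length u) u) where

  private
    n = length u
    m = suc n

  new∉u : N.mem m u ≡ false
  new∉u = suc∉permutation n u P

  inRange : ∀ {i} → N.mem i (oneTo n) ≡ true → 1 ≤ i × i ≤ n
  inRange {i} h = mem-oneTo⁻ n i h

  valueInRange : ∀ i → 1 ≤ i → i ≤ n → 1 ≤ at u i × at u i ≤ n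
  valueInRange i a b = IsPermutation.bounded P (at u i) (at-mem u i a b)

  withFixedPoint : List ℕ
  withFixedPoint = u ++ m ∷ []

  length-withFixedPoint : length withFixedPoint ≡ m
  length-withFixedPoint = trans (length-++ u) (+-comm n 1)

  length-insertAfter : ∀ a → length (insertAfter u a) ≡ m
  length-insertAfter a =
    trans (length-++ (setAt a m u)) (trans (+-comm (length (setAt a m u)) 1) (cong suc (length-setAt a m u)))

  at-withFixedPoint : ∀ i → i ≤ n → at withFixedPoint i ≡ at u i
  at-withFixedPoint i i≤n = at-++ u (m ∷ []) i i≤n

  at-withFixedPoint-new : at withFixedPoint m ≡ m
  at-withFixedPoint-new = at-last u m

  at-insertAfter : ∀ a i → 1 ≤ a → 1 ≤ i → i ≤ n → at (insertAfter u a) i ≡ (if i ≡ᵇ a then m else at u i)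
  at-insertAfter a i 1≤a 1≤i i≤n =
    trans (at-++ (setAt a m u) (at u a ∷ []) i (subst (i ≤_) (sym (length-setAt a m u)) i≤n)) (at-setAt a m u i 1≤i i≤n 1≤a)

  at-insertAfter-new : ∀ a → at (insertAfter u a) m ≡ at u a
  at-insertAfter-new a =
    trans (cong (λ l → at (insertAfter u a) (suc l)) (sym (length-setAt a m u))) (at-last (setAt a m u) (at u a))

  removeLargest-withFixedPoint : removeLargest withFixedPoint ≡ u
  removeLargest-withFixedPoint rewrite length-withFixedPoint | at-withFixedPoint-new | dropLast-snoc u m =
    replaceVal-∉ m m u new∉u

  removeLargest-insertAfter : ∀ a → 1 ≤ a → a ≤ n → removeLargest (insertAfter u a) ≡ u
  removeLargest-insertAfter a 1≤a a≤n
    rewrite length-insertAfter a | at-insertAfter-new a | dropLast-snoc (setAt a m u) (at u a) =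
    replaceVal-setAt m a u new∉u 1≤a a≤n

  isPerm-intro : ∀ v → length v ≡ m → (∀ j → 1 ≤ j → j ≤ m → N.mem j v ≡ true) → isPerm m v ≡ true
  isPerm-intro v len covers =
    ∧-true (T⇒≡true (≡⇒≡ᵇ (length v) m len)) (all-oneTo⁺ _ m (λ j a b → trans (elem≡mem j v) (covers j a b)))

  isPerm-withFixedPoint : isPerm m withFixedPoint ≡ true
  isPerm-withFixedPoint = isPerm-intro withFixedPoint length-withFixedPoint covers
    where
      covers : ∀ j → 1 ≤ j → j ≤ m → N.mem j withFixedPoint ≡ true
      covers j a b rewrite N.mem-++ j u (m ∷ []) with m≤n⇒m<n∨m≡n b
      ... | inj₁ lt rewrite IsPermutation.covers P j a (≤-pred lt) = refl
      ... | inj₂ refl rewrite ≡ᵇ-refl m = ∨-zeroʳ _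

  isPerm-insertAfter : ∀ a → 1 ≤ a → a ≤ n → isPerm m (insertAfter u a) ≡ true
  isPerm-insertAfter a 1≤a a≤n = isPerm-intro (insertAfter u a) (length-insertAfter a) covers
    where
      covers : ∀ j → 1 ≤ j → j ≤ m → N.mem j (insertAfter u a) ≡ true
      covers j h₁ h₂ rewrite N.mem-++ j (setAt a m u) (at u a ∷ []) with m≤n⇒m<n∨m≡n h₂
      ... | inj₂ refl rewrite mem-setAt-new a m u 1≤a a≤n = refl
      ... | inj₁ lt with j ≟ at u a
      ...   | yes refl rewrite ≡ᵇ-refl (at u a) = ∨-zeroʳ _
      ...   | no j≢ua rewrite mem-setAt-old a m u j (IsPermutation.covers P j h₁ (≤-pred lt)) j≢ua 1≤a a≤n = refl

  hasDoubleExc-withFixedPoint : hasDoubleExc withFixedPoint ≡ hasDoubleExc u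
  hasDoubleExc-withFixedPoint =
    trans (cong (λ l → any (doubleExcAt withFixedPoint) (oneTo l)) length-withFixedPoint)
      (trans (any-snoc (doubleExcAt withFixedPoint) (oneTo n) m)
        (trans (cong₂ _∨_ (any-cong-oneTo _ (doubleExcAt u) n old) new) (∨-identityʳ _)))
    where
      old : ∀ i → 1 ≤ i → i ≤ n → doubleExcAt withFixedPoint i ≡ doubleExcAt u i
      old i a b rewrite at-withFixedPoint i b | at-withFixedPoint (at u i) (proj₂ (valueInRange i a b)) = refl
      new : doubleExcAt withFixedPoint m ≡ false
      new rewrite at-withFixedPoint-new | <ᵇ-false {m} {m} ≤-refl = refl

  -- Only a ↦ m ↦ u(a) changed, and a < m < u(a) is impossible; so i ↦ a ↦ m is the only new
  -- candidate, and it is a double excedance iff i < a.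
  hasDoubleExc-insertAfter : hasDoubleExc u ≡ false → ∀ a → 1 ≤ a → a ≤ n →
    hasDoubleExc (insertAfter u a) ≡ isExcedanceValue u a
  hasDoubleExc-insertAfter ¬dexc a 1≤a a≤n =
    trans (cong (λ l → any (doubleExcAt v) (oneTo l)) (length-insertAfter a))
      (trans (any-snoc (doubleExcAt v) (oneTo n) m)
        (trans (cong₂ _∨_ (any-cong-oneTo (doubleExcAt v) _ n old) new) (∨-identityʳ _)))
    where
      v = insertAfter u a
      ua≤n = proj₂ (valueInRange a 1≤a a≤n)
      new : doubleExcAt v m ≡ false
      new rewrite at-insertAfter-new a | <ᵇ-false {m} {at u a} (m≤n⇒m≤1+n ua≤n) = refl
      old : ∀ i → 1 ≤ i → i ≤ n → doubleExcAt v i ≡ ((i <ᵇ a) ∧ (at u i ≡ᵇ a))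
      old i h₁ h₂ rewrite at-insertAfter a i 1≤a h₁ h₂ with i ≡ᵇ a in i≡a
      ... | true rewrite at-insertAfter-new a | <ᵇ-false {m} {at u a} (m≤n⇒m≤1+n ua≤n) | ≡ᵇ⇒≡′ {i} {a} i≡a
                       | <ᵇ-false {a} {a} ≤-refl = ∧-zeroʳ _
      ... | false rewrite at-insertAfter a (at u i) 1≤a (proj₁ (valueInRange i h₁ h₂)) (proj₂ (valueInRange i h₁ h₂))
          with at u i ≡ᵇ a in ui≡a
      ...   | true rewrite ≡ᵇ⇒≡′ {at u i} {a} ui≡a | <ᵇ-true {a} {m} (s≤s a≤n) = refl
      ...   | false = trans (N.any-false⁻ (doubleExcAt u) (oneTo n) i ¬dexc (mem-oneTo⁺ n i h₁ h₂)) (sym (∧-zeroʳ _))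

  exc-withFixedPoint : exc withFixedPoint ≡ exc u
  exc-withFixedPoint = begin
    exc withFixedPoint                                                     ≡⟨ exc≡countᵇ withFixedPoint ⟩
    countᵇ (isExcedance withFixedPoint) (oneTo (length withFixedPoint))    ≡⟨ cong (λ l → countᵇ (isExcedance withFixedPoint) (oneTo l)) length-withFixedPoint ⟩
    countᵇ (isExcedance withFixedPoint) (oneTo m)                          ≡⟨ countᵇ-oneTo-suc (isExcedance withFixedPoint) n ⟩
    countᵇ (isExcedance withFixedPoint) (oneTo n) + ⟦ isExcedance withFixedPoint m ⟧
      ≡⟨ cong₂ _+_ (countᵇ-cong-oneTo _ (isExcedance u) n (λ i _ b → cong (i <ᵇ_) (at-withFixedPoint i b))) new ⟩
    countᵇ (isExcedance u) (oneTo n) + 0                                   ≡⟨ +-identityʳ _ ⟩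
    countᵇ (isExcedance u) (oneTo n)                                       ≡⟨ exc≡countᵇ u ⟨
    exc u                                                                  ∎
    where
      open ≡-Reasoning
      new : ⟦ isExcedance withFixedPoint m ⟧ ≡ 0
      new rewrite at-withFixedPoint-new | <ᵇ-false {m} {m} ≤-refl = refl

  -- Only position a changed, and it is now an excedance (a ↦ m).
  exc-insertAfter : ∀ a → 1 ≤ a → a ≤ n → exc (insertAfter u a) ≡ (if isExcedance u a then exc u else suc (exc u))
  exc-insertAfter a 1≤a a≤n = begin
    exc v                                                 ≡⟨ exc≡countᵇ v ⟩
    countᵇ (isExcedance v) (oneTo (length v))             ≡⟨ cong (λ l → countᵇ (isExcedance v) (oneTo l)) (length-insertAfter a) ⟩
    countᵇ (isExcedance v) (oneTo m)                      ≡⟨ countᵇ-oneTo-suc (isExcedance v) n ⟩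
    countᵇ (isExcedance v) (oneTo n) + ⟦ isExcedance v m ⟧ ≡⟨ cong (countᵇ (isExcedance v) (oneTo n) +_) new ⟩
    countᵇ (isExcedance v) (oneTo n) + 0                  ≡⟨ +-identityʳ _ ⟩
    countᵇ (isExcedance v) (oneTo n)                      ≡⟨ +⟦⟧≡+1 _ _ (isExcedance u a) updated ⟩
    (if isExcedance u a then countᵇ (isExcedance u) (oneTo n) else suc (countᵇ (isExcedance u) (oneTo n)))
                                                          ≡⟨ cong (λ e → if isExcedance u a then e else suc e) (exc≡countᵇ u) ⟨
    (if isExcedance u a then exc u else suc (exc u))      ∎
    where
      open ≡-Reasoning
      v = insertAfter u a
      new : ⟦ isExcedance v m ⟧ ≡ 0
      new rewrite at-insertAfter-new a | <ᵇ-false {m} {at u a} (m≤n⇒m≤1+n (proj₂ (valueInRange a 1≤a a≤n))) = refl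
      a-excedance : isExcedance v a ≡ true
      a-excedance rewrite at-insertAfter a a 1≤a 1≤a a≤n | ≡ᵇ-refl a = <ᵇ-true (s≤s a≤n)
      updated : countᵇ (isExcedance v) (oneTo n) + ⟦ isExcedance u a ⟧ ≡ countᵇ (isExcedance u) (oneTo n) + 1
      updated = trans (countᵇ-oneTo-update (isExcedance v) (isExcedance u) n a 1≤a a≤n
                        (λ j h₁ h₂ j≢a → cong (j <ᵇ_) (trans (at-insertAfter a j 1≤a h₁ h₂)
                                                             (cong (λ b → if b then m else at u j) (N.≢⇒==-false j≢a)))))
                      (cong (λ b → countᵇ (isExcedance u) (oneTo n) + ⟦ b ⟧) a-excedance)

  excedanceValue⇒¬excedance : hasDoubleExc u ≡ false → ∀ a → isExcedanceValue u a ≡ true → isExcedance u a ≡ false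
  excedanceValue⇒¬excedance ¬dexc a h with N.any-true⁻ (λ i → (i <ᵇ a) ∧ (at u i ≡ᵇ a)) (oneTo n) h
  ... | (i , i∈ , i<a∧ui≡a) with ≡ᵇ⇒≡′ {at u i} {a} (∧-trueʳ {i <ᵇ a} i<a∧ui≡a)
  ...   | refl = ∧-true⇒ (∧-trueˡ i<a∧ui≡a) (N.any-false⁻ (doubleExcAt u) (oneTo n) i ¬dexc i∈)
    where
      ∧-true⇒ : ∀ {x y} → x ≡ true → x ∧ y ≡ false → y ≡ false
      ∧-true⇒ refl h = h

  -- i ↦ u(i) maps the excedances of u bijectively onto its excedance values.
  countᵇ-excedanceValues : countᵇ (isExcedanceValue u) (oneTo n) ≡ exc u
  countᵇ-excedanceValues =
    trans (sym (length-filterᵇ (isExcedanceValue u) (oneTo n)))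
      (trans (N.length-⊆-antisym values images nodup-values nodup-images values⊆images images⊆values) length-images)
    where
      excedances = filterᵇ (isExcedance u) (oneTo n)
      values = filterᵇ (isExcedanceValue u) (oneTo n)
      images = map (at u) excedances
      length-images : length images ≡ exc u
      length-images = trans (length-map (at u) excedances) (trans (length-filterᵇ (isExcedance u) (oneTo n)) (sym (exc≡countᵇ u)))
      mem-excedances : ∀ i → N.mem i excedances ≡ true → N.mem i (oneTo n) ≡ true × isExcedance u i ≡ true
      mem-excedances i h = let h′ = trans (sym (N.mem-filterᵇ i (isExcedance u) (oneTo n))) h
                           in ∧-trueˡ h′ , ∧-trueʳ {N.mem i (oneTo n)} h′
      nodup-values = N.nodup-filterᵇ (isExcedanceValue u) (oneTo n) (nodup-oneTo n)
      nodup-images = N.nodup-map (at u) excedances (N.nodup-filterᵇ (isExcedance u) (oneTo n) (nodup-oneTo n))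
        (λ x y mx my e → let (1≤x , x≤n) = inRange (proj₁ (mem-excedances x mx))
                             (1≤y , y≤n) = inRange (proj₁ (mem-excedances y my))
                         in at-injective u (IsPermutation.nodup P) x y 1≤x x≤n 1≤y y≤n e)
      values⊆images : ∀ z → N.mem z values ≡ true → N.mem z images ≡ true
      values⊆images z mz
        with N.any-true⁻ (λ i → (i <ᵇ z) ∧ (at u i ≡ᵇ z)) (oneTo n)
               (∧-trueʳ {N.mem z (oneTo n)} (trans (sym (N.mem-filterᵇ z (isExcedanceValue u) (oneTo n))) mz))
      ... | (i , i∈ , i<z∧ui≡z) = N.mem-subst images ui≡z
              (N.mem-map⁺ (at u) i excedances
                (trans (N.mem-filterᵇ i (isExcedance u) (oneTo n)) (∧-true i∈ (trans (cong (i <ᵇ_) ui≡z) (∧-trueˡ i<z∧ui≡z)))))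
        where ui≡z = ≡ᵇ⇒≡′ {at u i} {z} (∧-trueʳ {i <ᵇ z} i<z∧ui≡z)
      images⊆values : ∀ z → N.mem z images ≡ true → N.mem z values ≡ true
      images⊆values z mz with N.mem-map⁻ z (at u) excedances mz
      ... | (i , mi , refl) = trans (N.mem-filterᵇ (at u i) (isExcedanceValue u) (oneTo n))
              (∧-true (mem-oneTo⁺ n (at u i) (proj₁ ui-range) (proj₂ ui-range))
                 (N.any-true⁺ _ (oneTo n) i (proj₁ (mem-excedances i mi))
                   (∧-true (proj₂ (mem-excedances i mi)) (≡ᵇ-refl (at u i)))))
        where
          i-range = inRange (proj₁ (mem-excedances i mi))
          ui-range = valueInRange i (proj₁ i-range) (proj₂ i-range)

  mem-extensions⁻ : ∀ v → L.mem v (extensions u) ≡ true →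
    v ≡ withFixedPoint ⊎ Σ ℕ (λ a → (1 ≤ a × a ≤ n) × insertAfter u a ≡ v)
  mem-extensions⁻ v h with L.mem-∷ {v} {withFixedPoint} {map (insertAfter u) (oneTo n)} h
  ... | inj₁ e = inj₁ e
  ... | inj₂ m′ with mem-map-ℕ⁻ (insertAfter u) (oneTo n) v m′
  ...   | (a , a∈ , e) = inj₂ (a , inRange a∈ , e)

  -- Extensions differ in the image of the new letter.
  nodup-extensions : L.Nodup (extensions u)
  nodup-extensions =
    ≢true⇒≡false (λ mm → let (a , a∈ , e) = mem-map-ℕ⁻ (insertAfter u) (oneTo n) withFixedPoint mm in
      1+n≰n (subst (_≤ n) (trans (sym (at-insertAfter-new a)) (trans (cong (λ v → at v m) e) at-withFixedPoint-new))
                        (proj₂ (valueInRange a (proj₁ (inRange a∈)) (proj₂ (inRange a∈))))))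
    L.∷ₙ nodup-map-ℕ (insertAfter u) (oneTo n) (nodup-oneTo n)
      (λ a b a∈ b∈ e → at-injective u (IsPermutation.nodup P) a b (proj₁ (inRange a∈)) (proj₂ (inRange a∈))
                         (proj₁ (inRange b∈)) (proj₂ (inRange b∈))
                         (trans (sym (at-insertAfter-new a)) (trans (cong (λ v → at v m) e) (at-insertAfter-new b))))

  module _ (¬dexc : hasDoubleExc u ≡ false) where

    admissibleExcedances admissibleNonExcedances : ℕ
    admissibleExcedances = countᵇ (λ a → not (isExcedanceValue u a) ∧ isExcedance u a) (oneTo n)
    admissibleNonExcedances = countᵇ (λ a → not (isExcedanceValue u a) ∧ not (isExcedance u a)) (oneTo n)

    admissibleExcedances≡exc : admissibleExcedances ≡ exc u
    admissibleExcedances≡exc = sym (begin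
      exc u                                     ≡⟨ exc≡countᵇ u ⟩
      countᵇ (isExcedance u) (oneTo n)          ≡⟨ countᵇ-split (isExcedance u) (isExcedanceValue u) (oneTo n) ⟩
      countᵇ (λ a → isExcedance u a ∧ isExcedanceValue u a) (oneTo n)
        + countᵇ (λ a → isExcedance u a ∧ not (isExcedanceValue u a)) (oneTo n)
        ≡⟨ cong₂ _+_ (trans (countᵇ-cong _ _ (oneTo n) excedance∧value≡false) (countᵇ-false (oneTo n)))
                     (countᵇ-cong _ _ (oneTo n) (λ a → ∧-comm (isExcedance u a) _)) ⟩
      admissibleExcedances                      ∎)
      where
        open ≡-Reasoning
        excedance∧value≡false : ∀ a → (isExcedance u a ∧ isExcedanceValue u a) ≡ false
        excedance∧value≡false a with isExcedanceValue u a in value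
        ... | true = cong (_∧ true) (excedanceValue⇒¬excedance ¬dexc a value)
        ... | false = ∧-zeroʳ _

    -- The range splits into the exc u excedance values and the admissible positions.
    admissibleNonExcedances≡ : admissibleNonExcedances ≡ n ∸ (exc u + exc u)
    admissibleNonExcedances≡ =
      sym (trans (cong (_∸ (exc u + exc u)) (sym split)) (m+n∸n≡m admissibleNonExcedances (exc u + exc u)))
      where
        c = admissibleNonExcedances
        e = exc u
        identity : ∀ c e → c + (e + e) ≡ e + (e + c)
        identity = solve-∀
        split : c + (e + e) ≡ n
        split = begin
          c + (e + e)                                                          ≡⟨ identity c e ⟩
          e + (e + c)                                                          ≡⟨ cong₂ (λ x y → x + (y + c)) countᵇ-excedanceValues admissibleExcedances≡exc ⟨
          countᵇ (isExcedanceValue u) (oneTo n) + (admissibleExcedances + c)   ≡⟨ cong (countᵇ (isExcedanceValue u) (oneTo n) +_)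
                                                                                       (countᵇ-split (λ a → not (isExcedanceValue u a)) (isExcedance u) (oneTo n)) ⟨
          countᵇ (isExcedanceValue u) (oneTo n) + countᵇ (λ a → not (isExcedanceValue u a)) (oneTo n)
                                                                               ≡⟨ countᵇ+countᵇ-not (isExcedanceValue u) (oneTo n) ⟩
          length (oneTo n)                                                     ≡⟨ length-oneTo n ⟩
          n                                                                    ∎
          where open ≡-Reasoning

  isSimsun2-withFixedPoint : isSimsun2 withFixedPoint ≡ not (hasDoubleExc withFixedPoint) ∧ isSimsun2 u
  isSimsun2-withFixedPoint = isSimsun2-step withFixedPoint u length-withFixedPoint removeLargest-withFixedPoint

  isSimsun2-insertAfter : ∀ a → N.mem a (oneTo n) ≡ true →
    isSimsun2 (insertAfter u a) ≡ not (hasDoubleExc (insertAfter u a)) ∧ isSimsun2 u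
  isSimsun2-insertAfter a a∈ =
    isSimsun2-step (insertAfter u a) u (length-insertAfter a) (removeLargest-insertAfter a (proj₁ (inRange a∈)) (proj₂ (inRange a∈)))

  SS2WithExc : ℕ → List ℕ → Bool
  SS2WithExc k v = isSimsun2 v ∧ (exc v ≡ᵇ k)

  countᵇ-simsun2-extensions : ∀ k →
    countᵇ (SS2WithExc k) (extensions u) ≡ (if isSimsun2 u then weight n (exc u) k else 0)
  countᵇ-simsun2-extensions k with isSimsun2 u in simsun2-u
  ... | false =
    cong₂ _+_ (cong ⟦_⟧ fixed)
      (trans (countᵇ-map (SS2WithExc k) (insertAfter u) (oneTo n))
             (trans (N.countᵇ-cong-mem _ (λ _ → false) (oneTo n) inserted) (countᵇ-false (oneTo n))))
    where
      fixed : SS2WithExc k withFixedPoint ≡ false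
      fixed rewrite isSimsun2-withFixedPoint | simsun2-u | ∧-zeroʳ (not (hasDoubleExc withFixedPoint)) = refl
      inserted : ∀ a → N.mem a (oneTo n) ≡ true → SS2WithExc k (insertAfter u a) ≡ false
      inserted a a∈ rewrite isSimsun2-insertAfter a a∈ | simsun2-u | ∧-zeroʳ (not (hasDoubleExc (insertAfter u a))) = refl
  ... | true = begin
    ⟦ SS2WithExc k withFixedPoint ⟧ + countᵇ (SS2WithExc k) (map (insertAfter u) (oneTo n))
      ≡⟨ cong₂ _+_ (cong ⟦_⟧ fixed) (countᵇ-map (SS2WithExc k) (insertAfter u) (oneTo n)) ⟩
    ⟦ e ≡ᵇ k ⟧ + countᵇ (λ a → SS2WithExc k (insertAfter u a)) (oneTo n)
      ≡⟨ cong (⟦ e ≡ᵇ k ⟧ +_) (trans (N.countᵇ-cong-mem _ _ (oneTo n) inserted)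
                                     (countᵇ-if (isExcedanceValue u) (isExcedance u) e k (oneTo n))) ⟩
    ⟦ e ≡ᵇ k ⟧ + (⟦ e ≡ᵇ k ⟧ * admissibleExcedances ¬dexc + ⟦ suc e ≡ᵇ k ⟧ * admissibleNonExcedances ¬dexc)
      ≡⟨ cong₂ (λ x y → ⟦ e ≡ᵇ k ⟧ + (⟦ e ≡ᵇ k ⟧ * x + ⟦ suc e ≡ᵇ k ⟧ * y))
               (admissibleExcedances≡exc ¬dexc) (admissibleNonExcedances≡ ¬dexc) ⟩
    ⟦ e ≡ᵇ k ⟧ + (⟦ e ≡ᵇ k ⟧ * e + ⟦ suc e ≡ᵇ k ⟧ * (n ∸ (e + e)))
      ≡⟨ sym (+-assoc ⟦ e ≡ᵇ k ⟧ _ _) ⟩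
    ⟦ e ≡ᵇ k ⟧ + ⟦ e ≡ᵇ k ⟧ * e + ⟦ suc e ≡ᵇ k ⟧ * (n ∸ (e + e))
      ≡⟨ cong (_+ ⟦ suc e ≡ᵇ k ⟧ * (n ∸ (e + e))) (*-suc ⟦ e ≡ᵇ k ⟧ e) ⟨
    weight n e k ∎
    where
      open ≡-Reasoning
      e = exc u
      ¬dexc : hasDoubleExc u ≡ false
      ¬dexc = noDExcAfterRemovals⇒¬hasDoubleExc n u simsun2-u
      fixed : SS2WithExc k withFixedPoint ≡ (e ≡ᵇ k)
      fixed rewrite isSimsun2-withFixedPoint | simsun2-u | hasDoubleExc-withFixedPoint | ¬dexc | exc-withFixedPoint = refl
      inserted : ∀ a → N.mem a (oneTo n) ≡ true →
        SS2WithExc k (insertAfter u a) ≡ not (isExcedanceValue u a) ∧ ((if isExcedance u a then e else suc e) ≡ᵇ k)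
      inserted a a∈ rewrite isSimsun2-insertAfter a a∈ | simsun2-u | hasDoubleExc-insertAfter ¬dexc a (proj₁ (inRange a∈)) (proj₂ (inRange a∈))
                          | exc-insertAfter a (proj₁ (inRange a∈)) (proj₂ (inRange a∈))
                          | ∧-identityʳ (not (isExcedanceValue u a)) = refl

sumBelow : ℕ → (ℕ → ℕ) → ℕ
sumBelow zero h = 0
sumBelow (suc b) h = sumBelow b h + h b

sumBelow-zero : ∀ b h → (∀ d → d < b → h d ≡ 0) → sumBelow b h ≡ 0
sumBelow-zero zero h z = refl
sumBelow-zero (suc b) h z = cong₂ _+_ (sumBelow-zero b h (λ d lt → z d (m≤n⇒m≤1+n lt))) (z b ≤-refl)

sumBelow-cong : ∀ b h h′ → (∀ d → h d ≡ h′ d) → sumBelow b h ≡ sumBelow b h′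
sumBelow-cong zero h h′ e = refl
sumBelow-cong (suc b) h h′ e = cong₂ _+_ (sumBelow-cong b h h′ e) (e b)

sumBelow-+ : ∀ b h₁ h₂ → sumBelow b (λ d → h₁ d + h₂ d) ≡ sumBelow b h₁ + sumBelow b h₂
sumBelow-+ zero h₁ h₂ = refl
sumBelow-+ (suc b) h₁ h₂ rewrite sumBelow-+ b h₁ h₂ = interchange (sumBelow b h₁) (sumBelow b h₂) (h₁ b) (h₂ b)

sumBelow-indicator : ∀ b x c (g : ℕ → ℕ) → x < b → sumBelow b (λ d → ⟦ c ∧ (x ≡ᵇ d) ⟧ * g d) ≡ (if c then g x else 0)
sumBelow-indicator b x false g _ = sumBelow-zero b _ (λ d _ → refl)
sumBelow-indicator (suc b) x true g x<1+b with m≤n⇒m<n∨m≡n (≤-pred x<1+b)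
... | inj₁ x<b rewrite sumBelow-indicator b x true g x<b | N.≢⇒==-false {x} {b} (λ { refl → <-irrefl refl x<b }) =
  +-identityʳ _
... | inj₂ refl rewrite sumBelow-zero x (λ d → ⟦ x ≡ᵇ d ⟧ * g d)
                          (λ d d<x → cong (λ c → ⟦ c ⟧ * g d) (N.≢⇒==-false {x} {d} (λ { refl → <-irrefl refl d<x })))
                      | ≡ᵇ-refl x = +-identityʳ _

sumBy-group : ∀ (P : List ℕ → Bool) (f : List ℕ → ℕ) (g : ℕ → ℕ) b ws → (∀ w → L.mem w ws ≡ true → f w < b) →
  sumBy (λ w → if P w then g (f w) else 0) ws ≡ sumBelow b (λ d → countᵇ (λ w → P w ∧ (f w ≡ᵇ d)) ws * g d)
sumBy-group P f g b [] h = sym (sumBelow-zero b _ (λ d _ → refl))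
sumBy-group P f g b (w ∷ ws) h =
  trans (cong₂ _+_ (sym (sumBelow-indicator b (f w) (P w) g (h w (L.mem-here w ws))))
                   (sumBy-group P f g b ws (λ w′ m → h w′ (L.mem-there w′ w ws m))))
        (trans (sym (sumBelow-+ b _ _))
               (sumBelow-cong b _ _ (λ d → sym (*-distribʳ-+ (g d) ⟦ P w ∧ (f w ≡ᵇ d) ⟧ _))))

sum-map-filterᵇ : ∀ (h : List ℕ → ℕ) P ws → sum (map h (filterᵇ P ws)) ≡ sumBy (λ w → if P w then h w else 0) ws
sum-map-filterᵇ h P [] = refl
sum-map-filterᵇ h P (w ∷ ws) rewrite filterᵇ-∷ P w ws with P w
... | true = cong (h w +_) (sum-map-filterᵇ h P ws)
... | false = sum-map-filterᵇ h P ws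

≤-step-if : ∀ c {d l} → d ≤ l → (if c then 1 else 0) + d ≤ suc l
≤-step-if true le = s≤s le
≤-step-if false le = m≤n⇒m≤1+n le

des≤length : ∀ w → des w ≤ length w
des≤length [] = z≤n
des≤length (a ∷ []) = z≤n
des≤length (a ∷ b ∷ ws) = ≤-step-if (b <ᵇ a) (des≤length (b ∷ ws))

excFrom≤length : ∀ s w → excFrom s w ≤ length w
excFrom≤length s [] = z≤n
excFrom≤length s (x ∷ w) = ≤-step-if (s <ᵇ x) (excFrom≤length (suc s) w)

countRS countSS : ℕ → ℕ → ℕ
countRS n k = countᵇ (λ w → isSimsun w ∧ (des w ≡ᵇ k)) (perms n)
countSS n k = countᵇ (λ w → isSimsun2 w ∧ (exc w ≡ᵇ k)) (perms n)

mem-perms⇒IsPermutation′ : ∀ n u → L.mem u (perms n) ≡ true → IsPermutation (length u) u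
mem-perms⇒IsPermutation′ n u m =
  subst (λ l → IsPermutation l u) (sym (IsPermutation.length≡ (mem-perms⇒IsPermutation n u m))) (mem-perms⇒IsPermutation n u m)

countRS-suc : ∀ n k → countRS (suc n) k ≡ sumBy (λ u → if isSimsun u then weight n (des u) k else 0) (perms n)
countRS-suc n k = trans (countᵇ-concatMap _ (insertions (suc n)) (perms n))
  (L.sumBy-cong-mem _ _ (perms n) (λ u m → countᵇ-simsun-insertions n u (mem-perms⇒IsPermutation n u m) k))

module _ (n : ℕ) (u v : List ℕ) (u∈ : L.mem u (perms n) ≡ true) (v∈ : L.mem v (extensions u) ≡ true) where

  private
    open module E = Extension u (mem-perms⇒IsPermutation′ n u u∈)
    length-u = IsPermutation.length≡ (mem-perms⇒IsPermutation n u u∈)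

  isPerm-extensions : isPerm (suc n) v ≡ true
  isPerm-extensions with mem-extensions⁻ v v∈
  ... | inj₁ refl = subst (λ l → isPerm (suc l) v ≡ true) length-u isPerm-withFixedPoint
  ... | inj₂ (a , (1≤a , a≤n) , refl) = subst (λ l → isPerm (suc l) v ≡ true) length-u (isPerm-insertAfter a 1≤a a≤n)

  removeLargest-extensions : removeLargest v ≡ u
  removeLargest-extensions with mem-extensions⁻ v v∈
  ... | inj₁ refl = removeLargest-withFixedPoint
  ... | inj₂ (a , (1≤a , a≤n) , refl) = removeLargest-insertAfter a 1≤a a≤n

-- concatMap extensions (perms n) is duplicate-free, contained in perms (suc n) and equally long.
countSS-suc : ∀ n k → countSS (suc n) k ≡ sumBy (λ u → if isSimsun2 u then weight n (exc u) k else 0) (perms n)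
countSS-suc n k =
  trans (sym (L.countᵇ-⊆-length Q (concatMap extensions (perms n)) (perms (suc n)) nodup-all all⊆perms same-length))
    (trans (countᵇ-concatMap Q extensions (perms n))
      (L.sumBy-cong-mem _ _ (perms n) (λ u m →
        trans (Extension.countᵇ-simsun2-extensions u (mem-perms⇒IsPermutation′ n u m) k)
              (cong (λ l → if isSimsun2 u then weight l (exc u) k else 0) (IsPermutation.length≡ (mem-perms⇒IsPermutation n u m))))))
  where
    Q = λ w → isSimsun2 w ∧ (exc w ≡ᵇ k)
    nodup-all = L.nodup-concatMap extensions removeLargest (perms n) (nodup-perms n)
      (λ u m → Extension.nodup-extensions u (mem-perms⇒IsPermutation′ n u m))
      (λ u v m₁ m₂ → removeLargest-extensions n u v m₁ m₂)
    all⊆perms : ∀ v → L.mem v (concatMap extensions (perms n)) ≡ true → L.mem v (perms (suc n)) ≡ true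
    all⊆perms v v∈ with L.mem-concatMap⁻ v extensions (perms n) v∈
    ... | (u , m₁ , m₂) = isPerm⇒mem-perms (suc n) v (isPerm-extensions n u v m₁ m₂)
    count-blocks : ∀ (blocks : List ℕ → List (List ℕ)) → length (concatMap blocks (perms n)) ≡ sumBy (λ u → length (blocks u)) (perms n)
    count-blocks blocks = trans (sym (countᵇ-true (concatMap blocks (perms n))))
      (trans (countᵇ-concatMap (λ _ → true) blocks (perms n)) (L.sumBy-cong-mem _ _ (perms n) (λ u _ → countᵇ-true (blocks u))))
    same-length : length (concatMap extensions (perms n)) ≡ length (perms (suc n))
    same-length = trans (count-blocks extensions)
      (trans (L.sumBy-cong-mem _ _ (perms n) (λ u _ → trans (length-extensions u) (sym (length-insertions (suc n) u))))
             (sym (count-blocks (insertions (suc n)))))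

des<suc : ∀ n u → L.mem u (perms n) ≡ true → des u < suc n
des<suc n u m = s≤s (subst (des u ≤_) (IsPermutation.length≡ (mem-perms⇒IsPermutation n u m)) (des≤length u))

exc<suc : ∀ n u → L.mem u (perms n) ≡ true → exc u < suc n
exc<suc n u m = s≤s (subst (exc u ≤_) (IsPermutation.length≡ (mem-perms⇒IsPermutation n u m)) (excFrom≤length 1 u))

countRS≡countSS : ∀ n k → countRS n k ≡ countSS n k
countRS≡countSS zero k = refl
countRS≡countSS (suc n) k = begin
  countRS (suc n) k                                                   ≡⟨ countRS-suc n k ⟩
  sumBy (λ u → if isSimsun u then weight n (des u) k else 0) (perms n) ≡⟨ sumBy-group isSimsun des (λ d → weight n d k) (suc n) (perms n) (des<suc n) ⟩
  sumBelow (suc n) (λ d → countRS n d * weight n d k)                  ≡⟨ sumBelow-cong (suc n) _ _ (λ d → cong (_* weight n d k) (countRS≡countSS n d)) ⟩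
  sumBelow (suc n) (λ d → countSS n d * weight n d k)                  ≡⟨ sumBy-group isSimsun2 exc (λ d → weight n d k) (suc n) (perms n) (exc<suc n) ⟨
  sumBy (λ u → if isSimsun2 u then weight n (exc u) k else 0) (perms n) ≡⟨ countSS-suc n k ⟨
  countSS (suc n) k                                                   ∎
  where open ≡-Reasoning

desPoly≡excPoly : ∀ n x → desPoly n x ≡ excPoly n x
desPoly≡excPoly n x = begin
  desPoly n x                                          ≡⟨ sum-map-filterᵇ _ isSimsun (perms n) ⟩
  sumBy (λ u → if isSimsun u then x ^ des u else 0) (perms n)
                                                       ≡⟨ sumBy-group isSimsun des (x ^_) (suc n) (perms n) (des<suc n) ⟩
  sumBelow (suc n) (λ d → countRS n d * x ^ d)         ≡⟨ sumBelow-cong (suc n) _ _ (λ d → cong (_* x ^ d) (countRS≡countSS n d)) ⟩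
  sumBelow (suc n) (λ d → countSS n d * x ^ d)         ≡⟨ sumBy-group isSimsun2 exc (x ^_) (suc n) (perms n) (exc<suc n) ⟨
  sumBy (λ u → if isSimsun2 u then x ^ exc u else 0) (perms n)
                                                       ≡⟨ sum-map-filterᵇ _ isSimsun2 (perms n) ⟨
  excPoly n x                                          ∎
  where open ≡-Reasoning

Σ-T-↔ : ∀ (b₁ b₂ : List ℕ → Bool) → (∀ w → b₁ w ≡ b₂ w) → Σ (List ℕ) (λ w → T (b₁ w)) ↔ Σ (List ℕ) (λ w → T (b₂ w))
Σ-T-↔ b₁ b₂ e = mk↔ₛ′ (λ (w , t) → w , subst T (e w) t) (λ (w , t) → w , subst T (sym (e w)) t)
  (λ (w , t) → cong (w ,_) (T-irrelevant _ _)) (λ (w , t) → cong (w ,_) (T-irrelevant _ _))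

Fin-cong : ∀ {a b} → a ≡ b → Fin a ↔ Fin b
Fin-cong refl = mk↔ₛ′ (λ i → i) (λ i → i) (λ _ → refl) (λ _ → refl)

perms-satisfying↔Fin : ∀ n (Q : List ℕ → Bool) → Σ (List ℕ) (λ w → T (isPerm n w ∧ Q w)) ↔ Fin (countᵇ Q (perms n))
perms-satisfying↔Fin n Q =
  ↔-trans (Σ-T-↔ _ (λ w → L.mem w (filterᵇ Q (perms n)))
                   (λ w → trans (cong (_∧ Q w) (isPerm≡mem-perms n w)) (sym (L.mem-filterᵇ w Q (perms n)))))
    (↔-trans (L.members↔Fin (filterᵇ Q (perms n)) (L.nodup-filterᵇ Q (perms n) (nodup-perms n)))
             (Fin-cong (length-filterᵇ Q (perms n))))

RSk↔SSk : ∀ n k → RSk n k ↔ SSk n k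
RSk↔SSk n k =
  ↔-trans (perms-satisfying↔Fin n (λ w → isSimsun w ∧ (des w ≡ᵇ k)))
    (↔-trans (Fin-cong (countRS≡countSS n k)) (↔-sym (perms-satisfying↔Fin n (λ w → isSimsun2 w ∧ (exc w ≡ᵇ k)))))

mainTheorem10 : (n : ℕ) → 1 ≤ n →
    ((x : ℕ) → desPoly n x ≡ excPoly n x) × ((k : ℕ) → RSk n k ↔ SSk n k)
mainTheorem10 n _ = desPoly≡excPoly n , RSk↔SSk n
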